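{- Let $\mathbf{g},\mathbf{h},\mathbf{i},\mathbf{l}\in E$, $\tau\in\mathcal{U}_{\mathbf{g},\mathbf{h}}$ and $\sigma\in\mathcal{U}_{\mathbf{l},\mathbf{i}}$. Then $$B_{\mathbf{g},\mathbf{h},\tau}B_{\mathbf{l},\mathbf{i},\sigma}=\delta_{\mathbf{h},\mathbf{l}}\,\overline{k_{[\mathbf{g},\mathbf{h},\mathbf{i}]}}\,\overline{k_{\tau\setminus\mathbf{i}}}\,\overline{k_{\sigma\setminus\mathbf{g}}}\,\overline{k_{\tau\cap\sigma}}\,B_{\mathbf{g},\mathbf{i},(\mathbf{g},\mathbf{h},\mathbf{i},\tau,\sigma)},$$ where $\delta_{\mathbf{h},\mathbf{l}}\in\{\overline0,\overline1\}$ is the Kronecker delta.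
   Context: Let $\mathbb{F}$ be a field; for an integer $a$ let $\overline{a}$ be its image in $\mathbb{F}$. Let $[g,h]=\{a\in\mathbb{Z}:g\le a\le h\}$. Fix $n\ge1$ and integers $\ell_1,\dots,\ell_n,m_1,\dots,m_n\ge2$. For each $i\in[1,n]$ let $U_i$ be a set with $|U_i|=\ell_im_i$ partitioned into $\ell_i$ blocks of size $m_i$, with relations $R^i_0=\{(a,a)\}$, $R^i_1=\{(a,b):a\ne b\text{ in the same block}\}$, $R^i_2=\{(a,b):a,b\text{ in different blocks}\}$. Let $X=\prod_iU_i$, $E$ the set of $n$-tuples with entries in $\{0,1,2\}$, $R_{\mathbf{g}}=\{(\mathbf{a},\mathbf{b}):(\mathbf{a}_i,\mathbf{b}_i)\in R^i_{\mathbf{g}_i}\ \forall i\}$ for $\mathbf{g}\in E$. For $\mathbf{g}\in E$, $j\in\{0,1,2\}$ put $S_j(\mathbf{g})=\{a:\mathbf{g}_a=j\}$; for $V\subseteq[1,n]$ put $V^\bullet=\{a\in V:\ell_a>2\}$, $V^\circ=\{a\in V:m_a>2\}$. Fix $\mathbf{x}\in X$; $A_{\mathbf{g}}\in\mathrm{M}_X(\mathbb{F})$ is the $0/1$ adjacency matrix of $R_{\mathbf{g}}$, $E^*_{\mathbf{g}}$ is the diagonal matrix with $(\mathbf{y},\mathbf{y})$-entry $\overline1$ iff $(\mathbf{x},\mathbf{y})\in R_{\mathbf{g}}$; $O$ is the zero matrix. For triples $\tau=(J_1,J_2,J_3)$, $\sigma=(K_1,K_2,K_3)$ of subsets of $[1,n]$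 and $\mathbf{g}\in E$: $\tau\cap\sigma=(J_1\cap K_1,J_2\cap K_2,J_3\cap K_3)$, $\tau\setminus\mathbf{g}=(J_1\setminus S_1(\mathbf{g}),J_2\setminus S_2(\mathbf{g}),J_3\setminus S_2(\mathbf{g}))$. For $\mathbf{g},\mathbf{h}\in E$, $\mathcal{U}_{\mathbf{g},\mathbf{h}}$ is the set of triples $(J_1,J_2,J_3)$ with $J_1\subseteq(S_1(\mathbf{g})\cap S_1(\mathbf{h}))^\circ$, $J_2\subseteq(S_2(\mathbf{g})\cap S_2(\mathbf{h}))^\bullet$, $J_2\subseteq J_3\subseteq S_2(\mathbf{g})\cap S_2(\mathbf{h})$. For $\tau=(J_1,J_2,J_3)\in\mathcal{U}_{\mathbf{g},\mathbf{h}}$, $B_{\mathbf{g},\mathbf{h},\tau}=\sum E^*_{\mathbf{g}}A_{\mathbf{a}}E^*_{\mathbf{h}}$ over all $\mathbf{a}\in E$ with $E^*_{\mathbf{g}}A_{\mathbf{a}}E^*_{\mathbf{h}}\ne O$, $S_1(\mathbf{a})\cap(S_1(\mathbf{g})\cap S_1(\mathbf{h}))^\circ\subseteq J_1$, $S_2(\mathbf{a})\cap(S_2(\mathbf{g})\cap S_2(\mathbf{h}))^\bullet\subseteq J_2$, $S_1(\mathbf{a})\cap S_2(\mathbf{g})\cap S_2(\mathbf{h})\subseteq J_3$. For $U,V,W\subseteq[1,n]$ let $k_{(U,V,W)}=\prod_{j\in U}(m_j-1)\prod_{j\in V}(\ell_j-1)m_j\prod_{j\in W\setminus V}m_j$ (empty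 products $=1$); for a triple $\tau$, $k_\tau$ is this with $(U,V,W)=\tau$. For $\mathbf{g},\mathbf{h},\mathbf{i}\in E$ let $k_{[\mathbf{g},\mathbf{h},\mathbf{i}]}=k_{(U,V,V)}$ with $U=S_1(\mathbf{h})\setminus(S_1(\mathbf{g})\cup S_1(\mathbf{i}))$, $V=S_2(\mathbf{h})\setminus(S_2(\mathbf{g})\cup S_2(\mathbf{i}))$. For $\mathbf{g},\mathbf{h},\mathbf{i}\in E$ and triples $\tau=(J_1,J_2,J_3)$, $\sigma=(K_1,K_2,K_3)$, let $(\mathbf{g},\mathbf{h},\mathbf{i},\tau,\sigma)=(L_1,L_2,L_3)$ where $L_1=((S_1(\mathbf{g})\cap S_1(\mathbf{i}))^\circ\setminus S_1(\mathbf{h}))\cup(S_1(\mathbf{g})\cap S_1(\mathbf{i})\cap(J_1\cup K_1))$, $L_2=((S_2(\mathbf{g})\cap S_2(\mathbf{i}))^\bullet\setminus S_2(\mathbf{h}))\cup(S_2(\mathbf{g})\cap S_2(\mathbf{i})\cap(J_2\cup K_2))$, $L_3=((S_2(\mathbf{g})\cap S_2(\mathbf{i}))\setminus S_2(\mathbf{h}))\cup(S_2(\mathbf{g})\cap S_2(\mathbf{i})\cap(J_3\cup K_3))$; this triple lies in $\mathcal{U}_{\mathbf{g},\mathbf{i}}$. -}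

module Defs where

open import Level using (Level; _⊔_; suc)
open import Algebra.Bundles using (CommutativeRing)
open import Relation.Nullary using (¬_; Dec; yes; no)
open import Relation.Nullary.Decidable using (isYes)
open import Data.Product using (_×_; _,_; proj₁; proj₂; ∃)
open import Data.Bool using (Bool; true; false; _∧_; _∨_; if_then_else_)
open import Data.Nat as ℕ using (ℕ; zero; _∸_; _<ᵇ_)
open import Data.Fin as Fin using (Fin)
open import Data.Fin.Subset using (Subset; _∩_; _∪_; _─_; _⊆_)
open import Data.Fin.Subset.Properties using (_⊆?_)
open import Data.Vec using (tabulate; lookup)
open import Data.List using (List; []; _∷_; concatMap; map; foldr)
open import Data.Bool.ListAction using (all; any)
open import Data.List.Base using (allFin)
open import Relation.Binary.PropositionalEquality using (_≡_)

record Field (c ℓ : Level) : Set (Level.suc (c ⊔ ℓ)) where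
  field
    commutativeRing : CommutativeRing c ℓ
  open CommutativeRing commutativeRing public
  field
    1≉0     : ¬ (1# ≈ 0#)
    inverse : ∀ x → ¬ (x ≈ 0#) → ∃ λ y → x * y ≈ 1#

data Three : Set where
  r0 r1 r2 : Three

_==₃_ : Three → Three → Bool
r0 ==₃ r0 = true
r1 ==₃ r1 = true
r2 ==₃ r2 = true
_  ==₃ _  = false

allB : ∀ {n} → (Fin n → Bool) → Bool
allB {n} p = all p (allFin n)

-- U_i = Fin ℓ_i × Fin m_i, where the
-- first component is the block and the second the position in the block.

module Setup {c ℓ' : Level} (F : Field c ℓ') (n : ℕ) (ℓ m : Fin n → ℕ) where

  open Field F

  ι : ℕ → Carrier
  ι zero = 0#
  ι (ℕ.suc k) = 1# + ι k

  U : Fin n → Set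
  U i = Fin (ℓ i) × Fin (m i)

  X : Set
  X = (i : Fin n) → U i

  E : Set
  E = Fin n → Three

  relU : (i : Fin n) → U i → U i → Three
  relU i (b , p) (b' , p') with b Fin.≟ b' | p Fin.≟ p'
  ... | yes _ | yes _ = r0
  ... | yes _ | no  _ = r1
  ... | no  _ | _     = r2

  R : E → X → X → Bool
  R g a b = allB (λ i → relU i (a i) (b i) ==₃ g i)

  _=X_ : X → X → Bool
  a =X b = allB (λ i → isYes (proj₁ (a i) Fin.≟ proj₁ (b i)) ∧ isYes (proj₂ (a i) Fin.≟ proj₂ (b i)))

  consF : ∀ {k} {A : Fin (ℕ.suc k) → Set} → A Fin.zero → ((i : Fin k) → A (Fin.suc i)) → (i : Fin (ℕ.suc k)) → A i
  consF a f Fin.zero = a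
  consF a f (Fin.suc i) = f i

  enum : ∀ k (A : Fin k → Set) → ((i : Fin k) → List (A i)) → List ((i : Fin k) → A i)
  enum zero A L = (λ ()) ∷ []
  enum (ℕ.suc k) A L =
    concatMap (λ a → map (consF {A = A} a) (enum k (λ i → A (Fin.suc i)) (λ i → L (Fin.suc i)))) (L Fin.zero)

  allU : (i : Fin n) → List (U i)
  allU i = concatMap (λ b → map (b ,_) (allFin (m i))) (allFin (ℓ i))

  allX : List X
  allX = enum n U allU

  allE : List E
  allE = enum n (λ _ → Three) (λ _ → r0 ∷ r1 ∷ r2 ∷ [])

  Mat : Set c
  Mat = X → X → Carrier

  O : Mat
  O _ _ = 0#

  _+M_ : Mat → Mat → Mat
  (A +M B) a b = A a b + B a b

  _*M_ : Mat → Mat → Mat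
  (A *M B) a b = foldr (λ z s → A a z * B z b + s) 0# (allX)

  _·M_ : Carrier → Mat → Mat
  (k ·M A) a b = k * A a b

  _≈M_ : Mat → Mat → Set ℓ'
  A ≈M B = ∀ a b → A a b ≈ B a b

  ΣM : List Mat → Mat
  ΣM = foldr _+M_ O

  δ : E → E → Carrier
  δ g h = if allB (λ i → g i ==₃ h i) then 1# else 0#

  S : Three → E → Subset n
  S j g = tabulate (λ a → g a ==₃ j)

  _• : Subset n → Subset n
  V • = tabulate (λ a → lookup V a ∧ (2 <ᵇ ℓ a))

  _∘ : Subset n → Subset n
  V ∘ = tabulate (λ a → lookup V a ∧ (2 <ᵇ m a))

  _⊆ᵇ_ : Subset n → Subset n → Bool
  P ⊆ᵇ Q = isYes (P ⊆? Q)

  Triple : Set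
  Triple = Subset n × Subset n × Subset n

  _∩T_ : Triple → Triple → Triple
  (J₁ , J₂ , J₃) ∩T (K₁ , K₂ , K₃) = (J₁ ∩ K₁ , J₂ ∩ K₂ , J₃ ∩ K₃)

  _∖_ : Triple → E → Triple
  (J₁ , J₂ , J₃) ∖ g = (J₁ ─ S r1 g , J₂ ─ S r2 g , J₃ ─ S r2 g)

  InU : E → E → Triple → Set
  InU g h (J₁ , J₂ , J₃) =
    (J₁ ⊆ ((S r1 g ∩ S r1 h) ∘)) × (J₂ ⊆ ((S r2 g ∩ S r2 h) •)) × (J₂ ⊆ J₃) × (J₃ ⊆ (S r2 g ∩ S r2 h))

  ∏ : Subset n → (Fin n → ℕ) → ℕ
  ∏ V f = foldr (λ j r → (if lookup V j then f j else 1) ℕ.* r) 1 (allFin n)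

  k₃ : Subset n → Subset n → Subset n → ℕ
  k₃ U' V W = ∏ U' (λ j → m j ∸ 1) ℕ.* ∏ V (λ j → (ℓ j ∸ 1) ℕ.* m j) ℕ.* ∏ (W ─ V) m

  kT : Triple → ℕ
  kT (U' , V , W) = k₃ U' V W

  k[_,_,_] : E → E → E → ℕ
  k[ g , h , i ] = k₃ U' V V
    where
      U' = S r1 h ─ (S r1 g ∪ S r1 i)
      V  = S r2 h ─ (S r2 g ∪ S r2 i)

  comb : E → E → E → Triple → Triple → Triple
  comb g h i (J₁ , J₂ , J₃) (K₁ , K₂ , K₃) = (L₁ , L₂ , L₃)
    where
      L₁ = (((S r1 g ∩ S r1 i) ∘) ─ S r1 h) ∪ (S r1 g ∩ S r1 i ∩ (J₁ ∪ K₁))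
      L₂ = (((S r2 g ∩ S r2 i) •) ─ S r2 h) ∪ (S r2 g ∩ S r2 i ∩ (J₂ ∪ K₂))
      L₃ = ((S r2 g ∩ S r2 i) ─ S r2 h) ∪ (S r2 g ∩ S r2 i ∩ (J₃ ∪ K₃))

  module Base (x : X) where

    A : E → Mat
    A g a b = if R g a b then 1# else 0#

    E* : E → Mat
    E* g a b = if (a =X b) ∧ R g x a then 1# else 0#

    -- E*_g A_a E*_h ≠ O.  Its (y,z)-entry is the product of the three
    -- 0/1 values [x R_g y], [y R_a z], [x R_h z]; since 1 ≠ 0 in a field,
    -- the matrix is nonzero iff some such entry is 1.
    nonzero : E → E → E → Bool
    nonzero g a h = any (λ y → any (λ z → R g x y ∧ R a y z ∧ R h x z) allX) allX

    admissible : E → E → Triple → E → Bool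
    admissible g h (J₁ , J₂ , J₃) a =
      nonzero g a h
      ∧ ((S r1 a ∩ ((S r1 g ∩ S r1 h) ∘)) ⊆ᵇ J₁)
      ∧ ((S r2 a ∩ ((S r2 g ∩ S r2 h) •)) ⊆ᵇ J₂)
      ∧ ((S r1 a ∩ S r2 g ∩ S r2 h) ⊆ᵇ J₃)

    B : E → E → Triple → Mat
    B g h τ = ΣM (map (λ a → (E* g *M A a) *M E* h) (filterB (admissible g h τ) allE))
      where
        filterB : (E → Bool) → List E → List E
        filterB p [] = []
        filterB p (a ∷ as) = if p a then a ∷ filterB p as else filterB p as

{-# OPTIONS --safe #-}
-- All matrices involved are tensor products over the n coordinates: E*_g, A_a, hence
-- E*_g A_a E*_h, have entries that are products of local 0/1 factors, and the conditions
-- selecting the summands of B are coordinatewise, so B_{g,h,τ} = ⨂_j β_j where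
-- β_j(u,w) = [rel(x_j,u) = g_j] [rel(u,w) admissible for τ at j] [rel(x_j,w) = h_j].
-- A product of tensor products is the tensor product of the local products, and the
-- scalar factors over j as well, so the theorem reduces to an identity on one factor
-- U = Fin L × Fin M: the number of v with β(y,v) and β′(v,z) is κ · β″(y,z).  That number
-- depends only on the equality pattern of the blocks and of the positions of x, y, z;
-- summing over blocks and then positions, each sum over three marked points in closed
-- form, it becomes a polynomial in L and M.  Writing L = 2 or L = 3 + X (the
-- conditions only see whether L > 2), and likewise M, leaves finitely many identities
-- between polynomials in X and Y over ℕ, which are checked by normalisation.
module Submission where

open import Level using (Level; 0ℓ)
open import Algebra.Bundles using (CommutativeSemiring)
open import Algebra.Bundles.Raw using (RawSemiring)
open import Data.Bool using (Bool; true; false; not; _∧_; _∨_; if_then_else_; T)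
open import Data.Bool.Properties using (∧-zeroʳ; ∧-identityʳ; T-≡)
open import Function.Bundles using (Equivalence)
open import Data.Fin using (Fin; zero; suc)
open import Data.Fin.Properties using (_≟_)
open import Data.List using (List; []; _∷_; _++_; map; concatMap; foldr; tabulate)
open import Data.List.Base using (allFin)
open import Data.Bool.ListAction using (all; and)
open import Data.List.Properties using (map-cong)
open import Data.List.Membership.Propositional using (_∈_; lose)
open import Data.List.Membership.Propositional.Properties using (∈-map⁺; ∈-concat⁺′; ∈-allFin)
open import Data.List.Relation.Unary.Any using (here)
open import Data.List.Relation.Unary.Any.Properties using (any⁺)
open import Data.Fin.Subset using (Subset; _∩_; _∪_; _─_; _⊆_)
open import Data.Fin.Subset.Properties using (_⊆?_)
open import Data.Maybe using (Maybe; just; nothing; from-just)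
import Data.Maybe as Maybe
open import Data.Nat as ℕ using (ℕ; _∸_; _≤_; _<ᵇ_; z≤n; s≤s)
import Data.Nat.Properties as ℕₚ
open import Data.Nat.Properties using (+-*-commutativeSemiring; *-zeroʳ; +-∸-comm; m+n∸m≡n; +-mono-≤; *-mono-≤; ≤-refl)
open import Data.Nat.Solver using (module +-*-Solver)
open import Data.Product using (_×_; _,_; proj₁; proj₂; ∃)
open import Data.Vec using (Vec; _∷_; []; lookup)
open import Data.Vec.Properties using (lookup∘tabulate; lookup-zipWith; []=⇒lookup; lookup⇒[]=)
open import Function using (id; _∘_)
open import Relation.Nullary.Decidable using (isYes; yes; no)
open import Relation.Binary.Definitions using (DecidableEquality)
open import Relation.Nullary.Negation using (contradiction)
open import Relation.Binary.PropositionalEquality as ≡ using (_≡_; _≢_)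

open import Defs

infixr 4 _⇒_
_⇒_ : Bool → Bool → Bool
a ⇒ b = not a ∨ b

_==_ : ∀ {k} → Fin k → Fin k → Bool
zero  == zero  = true
zero  == suc _ = false
suc _ == zero  = false
suc a == suc b = a == b

==-refl : ∀ {k} (a : Fin k) → (a == a) ≡ true
==-refl zero    = ≡.refl
==-refl (suc a) = ==-refl a

==-sym : ∀ {k} (a b : Fin k) → (a == b) ≡ (b == a)
==-sym zero    zero    = ≡.refl
==-sym zero    (suc b) = ≡.refl
==-sym (suc a) zero    = ≡.refl
==-sym (suc a) (suc b) = ==-sym a b

==-sound : ∀ {k} {a b : Fin k} → T (a == b) → a ≡ b
==-sound {a = zero}  {zero}  _ = ≡.refl
==-sound {a = suc a} {suc b} e = ≡.cong suc (==-sound e)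

==-≢ : ∀ {k} {a b : Fin k} → a ≢ b → (a == b) ≡ false
==-≢ {a = zero}  {zero}  a≢b = contradiction ≡.refl a≢b
==-≢ {a = zero}  {suc b} _   = ≡.refl
==-≢ {a = suc a} {zero}  _   = ≡.refl
==-≢ {a = suc a} {suc b} a≢b = ==-≢ (a≢b ∘ ≡.cong suc)

isYes-≟ : ∀ {k} (a b : Fin k) → isYes (a ≟ b) ≡ (a == b)
isYes-≟ a b with a ≟ b
... | yes ≡.refl = ≡.sym (==-refl a)
... | no a≢b   = ≡.sym (==-≢ a≢b)

==-symᵀ : ∀ {k} {a b : Fin k} → T (a == b) → T (b == a)
==-symᵀ {a = a} {b} = ≡.subst T (==-sym a b)

==-trans : ∀ {k} {a b c : Fin k} → T (a == b) → T (b == c) → T (a == c)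
==-trans {a = a} {b} {c} a=b = ≡.subst (λ x → T (x == c)) (≡.sym (==-sound {a = a} {b} a=b))

_≟₃_ : DecidableEquality Three
r0 ≟₃ r0 = yes ≡.refl
r0 ≟₃ r1 = no λ ()
r0 ≟₃ r2 = no λ ()
r1 ≟₃ r0 = no λ ()
r1 ≟₃ r1 = yes ≡.refl
r1 ≟₃ r2 = no λ ()
r2 ≟₃ r0 = no λ ()
r2 ≟₃ r1 = no λ ()
r2 ≟₃ r2 = yes ≡.refl

==₃-≢ : ∀ {a b} → a ≢ b → (a ==₃ b) ≡ false
==₃-≢ {r0} {r0} a≢b = contradiction ≡.refl a≢b
==₃-≢ {r0} {r1} _   = ≡.refl
==₃-≢ {r0} {r2} _   = ≡.refl
==₃-≢ {r1} {r0} _   = ≡.refl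
==₃-≢ {r1} {r1} a≢b = contradiction ≡.refl a≢b
==₃-≢ {r1} {r2} _   = ≡.refl
==₃-≢ {r2} {r0} _   = ≡.refl
==₃-≢ {r2} {r1} _   = ≡.refl
==₃-≢ {r2} {r2} a≢b = contradiction ≡.refl a≢b

module Sums {c ℓ} (R : CommutativeSemiring c ℓ) where
  open CommutativeSemiring R hiding (zero)
  open import Algebra.Properties.Semiring.Sum semiring public
    using (sum-syntax; sum-cong-≋; ∑-distrib-+; *-distribˡ-sum; *-distribʳ-sum)
  open import Relation.Binary.Reasoning.Setoid setoid

  [_] : Bool → Carrier
  [ b ] = if b then 1# else 0#

  [∧] : ∀ a b → [ a ∧ b ] ≈ [ a ] * [ b ]
  [∧] true  b = sym (*-identityˡ _)
  [∧] false b = sym (zeroˡ _)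

  private variable
    a b : Level
    A B : Set a

  ∑ₗ : List A → (A → Carrier) → Carrier
  ∑ₗ xs f = foldr (λ x s → f x + s) 0# xs

  ∑ₗ-cong : ∀ (xs : List A) {f g : A → Carrier} → (∀ x → f x ≈ g x) → ∑ₗ xs f ≈ ∑ₗ xs g
  ∑ₗ-cong []       f≈g = refl
  ∑ₗ-cong (x ∷ xs) f≈g = +-cong (f≈g x) (∑ₗ-cong xs f≈g)

  ∑ₗ-zero : ∀ (xs : List A) {f : A → Carrier} → (∀ x → f x ≈ 0#) → ∑ₗ xs f ≈ 0#
  ∑ₗ-zero []       f≈0 = refl
  ∑ₗ-zero (x ∷ xs) f≈0 = trans (+-cong (f≈0 x) (∑ₗ-zero xs f≈0)) (+-identityˡ 0#)

  ∑ₗ-++ : ∀ (xs ys : List A) (f : A → Carrier) → ∑ₗ (xs ++ ys) f ≈ ∑ₗ xs f + ∑ₗ ys f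
  ∑ₗ-++ []       ys f = sym (+-identityˡ _)
  ∑ₗ-++ (x ∷ xs) ys f = trans (+-congˡ (∑ₗ-++ xs ys f)) (sym (+-assoc _ _ _))

  *-distribˡ-∑ₗ : ∀ k (xs : List A) (f : A → Carrier) → k * ∑ₗ xs f ≈ ∑ₗ xs (λ x → k * f x)
  *-distribˡ-∑ₗ k []       f = zeroʳ k
  *-distribˡ-∑ₗ k (x ∷ xs) f = trans (distribˡ k _ _) (+-congˡ (*-distribˡ-∑ₗ k xs f))

  *-distribʳ-∑ₗ : ∀ k (xs : List A) (f : A → Carrier) → ∑ₗ xs f * k ≈ ∑ₗ xs (λ x → f x * k)
  *-distribʳ-∑ₗ k []       f = zeroˡ k
  *-distribʳ-∑ₗ k (x ∷ xs) f = trans (distribʳ k _ _) (+-congˡ (*-distribʳ-∑ₗ k xs f))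

  ∑ₗ-concatMap : (g : A → List B) (xs : List A) (f : B → Carrier) →
                 ∑ₗ (concatMap g xs) f ≈ ∑ₗ xs (λ x → ∑ₗ (g x) f)
  ∑ₗ-concatMap g []       f = refl
  ∑ₗ-concatMap g (x ∷ xs) f = trans (∑ₗ-++ (g x) (concatMap g xs) f) (+-congˡ (∑ₗ-concatMap g xs f))

  ∑ₗ-map : (g : B → A) (xs : List B) (f : A → Carrier) → ∑ₗ (map g xs) f ≡ ∑ₗ xs (f ∘ g)
  ∑ₗ-map g []       f = ≡.refl
  ∑ₗ-map g (x ∷ xs) f = ≡.cong (f (g x) +_) (∑ₗ-map g xs f)

  ∑ₗ-tabulate : ∀ {k} (g : Fin k → A) (f : A → Carrier) → ∑ₗ (tabulate g) f ≡ ∑[ i < k ] f (g i)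
  ∑ₗ-tabulate {k = ℕ.zero}  g f = ≡.refl
  ∑ₗ-tabulate {k = ℕ.suc k} g f = ≡.cong (f (g zero) +_) (∑ₗ-tabulate (g ∘ suc) f)

  ∑ₗ-grid : ∀ {L M} (f : Fin L × Fin M → Carrier) →
            ∑ₗ (concatMap (λ b → map (b ,_) (allFin M)) (allFin L)) f ≈ ∑[ b < L ] ∑[ p < M ] f (b , p)
  ∑ₗ-grid {L} {M} f = begin
    ∑ₗ (concatMap (λ b → map (b ,_) (allFin M)) (allFin L)) f ≈⟨ ∑ₗ-concatMap _ (allFin L) f ⟩
    ∑ₗ (allFin L) (λ b → ∑ₗ (map (b ,_) (allFin M)) f)       ≡⟨ ∑ₗ-tabulate {k = L} id _ ⟩
    ∑[ b < L ] ∑ₗ (map (b ,_) (allFin M)) f                  ≈⟨ sum-cong-≋ {L} row ⟩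
    ∑[ b < L ] ∑[ p < M ] f (b , p)                           ∎
    where
      row : ∀ b → ∑ₗ (map (b ,_) (allFin M)) f ≈ ∑[ p < M ] f (b , p)
      row b = reflexive (≡.trans (∑ₗ-map (b ,_) (allFin M) f) (∑ₗ-tabulate {k = M} id _))

  private
    keep : ∀ {x y} → y ≈ 0# → 1# * x + y ≈ x
    keep y≈0 = trans (+-cong (*-identityˡ _) y≈0) (+-identityʳ _)

    skip : ∀ {x y z} → y ≈ z → 0# * x + y ≈ z
    skip y≈z = trans (+-congʳ (zeroˡ _)) (trans (+-identityˡ _) y≈z)

  ∑-delta : ∀ {k} (d : Fin k) (f : Fin k → Carrier) → ∑[ p < k ] ([ d == p ] * f p) ≈ f d
  ∑-delta {ℕ.suc k} zero    f = keep (trans (sym (*-distribˡ-sum {k} 0# (f ∘ suc))) (zeroˡ _))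
  ∑-delta           (suc d) f = skip (∑-delta d (f ∘ suc))

  ∑-delta₃ : ∀ r (f : Three → Carrier) → ∑ₗ (r0 ∷ r1 ∷ r2 ∷ []) (λ t → [ r ==₃ t ] * f t) ≈ f r
  ∑-delta₃ r0 f = keep (skip (skip refl))
  ∑-delta₃ r1 f = skip (keep (skip refl))
  ∑-delta₃ r2 f = skip (skip (keep refl))

  [_]-absorbs : ∀ b {q} → (T q → T b) → [ b ] * [ q ] ≈ [ q ]
  [ b     ]-absorbs {false} _      = zeroʳ _
  [ true  ]-absorbs {true}  _      = *-identityˡ _
  [ false ]-absorbs {true}  q⇒b = contradiction _ q⇒b

  ∑-peel : ∀ {k} (d : Fin k) (F : Bool → Fin k → Carrier) →
           ∑[ p < k ] F (d == p) p ≈ F true d + ∑[ p < k ] ([ not (d == p) ] * F false p)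
  ∑-peel {k} d F = begin
    ∑[ p < k ] F (d == p) p
      ≈⟨ sum-cong-≋ {k} (λ p → split (d == p) p) ⟩
    ∑[ p < k ] ([ d == p ] * F true p + [ not (d == p) ] * F false p)
      ≈⟨ ∑-distrib-+ {k} _ _ ⟩
    ∑[ p < k ] ([ d == p ] * F true p) + ∑[ p < k ] ([ not (d == p) ] * F false p)
      ≈⟨ +-congʳ (∑-delta d (F true)) ⟩
    F true d + ∑[ p < k ] ([ not (d == p) ] * F false p) ∎
    where
      split : ∀ b p → F b p ≈ [ b ] * F true p + [ not b ] * F false p
      split true  p = sym (trans (+-cong (*-identityˡ _) (zeroˡ _)) (+-identityʳ _))
      split false p = sym (trans (+-cong (zeroˡ _) (*-identityˡ _)) (+-identityˡ _))

  outside : ∀ {k} → Fin k → Fin k → Fin k → Carrier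
  outside {k} a b c = ∑[ p < k ] ([ not (c == p) ] * ([ not (b == p) ] * [ not (a == p) ]))

  ∑-three-points : ∀ {k} (a b c : Fin k) (Ψ : Bool → Bool → Bool → Carrier) →
    ∑[ p < k ] Ψ (a == p) (b == p) (c == p) ≈
    Ψ true (a == b) (a == c) + ([ not (a == b) ] * Ψ false true (b == c) +
      ([ not (b == c) ] * ([ not (a == c) ] * Ψ false false true) + outside a b c * Ψ false false false))
  ∑-three-points {k} a b c Ψ = begin
    ∑[ p < k ] Ψ (a == p) (b == p) (c == p)
      ≈⟨ ∑-peel a (λ x p → Ψ x (b == p) (c == p)) ⟩
    Ψ true (b == a) (c == a) + ∑[ p < k ] ([ not (a == p) ] * Ψ false (b == p) (c == p))
      ≈⟨ +-congˡ (∑-peel b (λ x p → [ not (a == p) ] * Ψ false x (c == p))) ⟩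
    Ψ true (b == a) (c == a) + ([ not (a == b) ] * Ψ false true (c == b) +
      ∑[ p < k ] ([ not (b == p) ] * ([ not (a == p) ] * Ψ false false (c == p))))
      ≈⟨ +-congˡ (+-congˡ (∑-peel c (λ x p → [ not (b == p) ] * ([ not (a == p) ] * Ψ false false x)))) ⟩
    Ψ true (b == a) (c == a) + ([ not (a == b) ] * Ψ false true (c == b) +
      ([ not (b == c) ] * ([ not (a == c) ] * Ψ false false true) +
       ∑[ p < k ] ([ not (c == p) ] * ([ not (b == p) ] * ([ not (a == p) ] * Ψ false false false)))))
      ≈⟨ +-congˡ (+-congˡ (+-congˡ (trans (sum-cong-≋ {k} regroup)
                                          (sym (*-distribʳ-sum {k} (Ψ false false false) _))))) ⟩
    Ψ true (b == a) (c == a) + ([ not (a == b) ] * Ψ false true (c == b) +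
      ([ not (b == c) ] * ([ not (a == c) ] * Ψ false false true) + outside a b c * Ψ false false false))
      ≡⟨ ≡.cong₂ (λ ba ca → Ψ true ba ca + ([ not (a == b) ] * Ψ false true (c == b) + rest))
                 (==-sym b a) (==-sym c a) ⟩
    Ψ true (a == b) (a == c) + ([ not (a == b) ] * Ψ false true (c == b) + rest)
      ≡⟨ ≡.cong (λ cb → Ψ true (a == b) (a == c) + ([ not (a == b) ] * Ψ false true cb + rest)) (==-sym c b) ⟩
    Ψ true (a == b) (a == c) + ([ not (a == b) ] * Ψ false true (b == c) + rest) ∎
    where
      regroup : ∀ p → [ not (c == p) ] * ([ not (b == p) ] * ([ not (a == p) ] * Ψ false false false)) ≈
                      [ not (c == p) ] * ([ not (b == p) ] * [ not (a == p) ]) * Ψ false false false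
      regroup p = trans (*-congˡ (sym (*-assoc _ _ _))) (sym (*-assoc _ _ _))
      rest = [ not (b == c) ] * ([ not (a == c) ] * Ψ false false true) + outside a b c * Ψ false false false

module ℕSums = Sums +-*-commutativeSemiring

relation : Bool → Bool → Three
relation sameBlock samePosition = if sameBlock then (if samePosition then r0 else r1) else r2

-- Coordinatewise forms (subscript ₗ) of the paper's notions: at a coordinate j a triple
-- (J₁, J₂, J₃) is seen as its three memberships of j, and bigL, bigM say whether ℓ_j > 2, m_j > 2.
LocalTriple : Set
LocalTriple = Bool × Bool × Bool

module _ (bigL bigM : Bool) where

  admissibleₗ : Three → Three → LocalTriple → Three → Bool
  admissibleₗ g h (t₁ , t₂ , t₃) a =
    ((a ==₃ r1) ∧ ((g ==₃ r1) ∧ (h ==₃ r1)) ∧ bigM ⇒ t₁) ∧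
    ((a ==₃ r2) ∧ ((g ==₃ r2) ∧ (h ==₃ r2)) ∧ bigL ⇒ t₂) ∧
    ((a ==₃ r1) ∧ (g ==₃ r2) ∧ (h ==₃ r2) ⇒ t₃)

  inUₗ : Three → Three → LocalTriple → Bool
  inUₗ g h (t₁ , t₂ , t₃) =
    (t₁ ⇒ ((g ==₃ r1) ∧ (h ==₃ r1)) ∧ bigM) ∧ (t₂ ⇒ ((g ==₃ r2) ∧ (h ==₃ r2)) ∧ bigL) ∧
    (t₂ ⇒ t₃) ∧ (t₃ ⇒ (g ==₃ r2) ∧ (h ==₃ r2))

  βₗ : Three → Three → LocalTriple → Three → Three → Three → Bool
  βₗ g h t rxu rxw ruw = admissibleₗ g h t ruw ∧ (rxu ==₃ g) ∧ (rxw ==₃ h)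

  combₗ : Three → Three → Three → LocalTriple → LocalTriple → LocalTriple
  combₗ g h i (t₁ , t₂ , t₃) (s₁ , s₂ , s₃) =
    ( (((g ==₃ r1) ∧ (i ==₃ r1)) ∧ bigM) ∧ not (h ==₃ r1) ∨ (g ==₃ r1) ∧ (i ==₃ r1) ∧ (t₁ ∨ s₁)
    , (((g ==₃ r2) ∧ (i ==₃ r2)) ∧ bigL) ∧ not (h ==₃ r2) ∨ (g ==₃ r2) ∧ (i ==₃ r2) ∧ (t₂ ∨ s₂)
    , ((g ==₃ r2) ∧ (i ==₃ r2)) ∧ not (h ==₃ r2) ∨ (g ==₃ r2) ∧ (i ==₃ r2) ∧ (t₃ ∨ s₃) )

module _ {bigL bigM : Bool} (g h : Three) (t : LocalTriple) (rxu rxw ruw : Three) where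

  βₗ-vanishesˡ : (rxu ==₃ g) ≡ false → βₗ bigL bigM g h t rxu rxw ruw ≡ false
  βₗ-vanishesˡ e rewrite e = ∧-zeroʳ _

  βₗ-vanishesʳ : (rxw ==₃ h) ≡ false → βₗ bigL bigM g h t rxu rxw ruw ≡ false
  βₗ-vanishesʳ e rewrite e =
    ≡.trans (≡.cong (admissibleₗ bigL bigM g h t ruw ∧_) (∧-zeroʳ (rxu ==₃ g))) (∧-zeroʳ _)

_∖ₗ_ : LocalTriple → Three → LocalTriple
(t₁ , t₂ , t₃) ∖ₗ g = (t₁ ∧ not (g ==₃ r1) , t₂ ∧ not (g ==₃ r2) , t₃ ∧ not (g ==₃ r2))

_∩ₗ_ : LocalTriple → LocalTriple → LocalTriple
(t₁ , t₂ , t₃) ∩ₗ (s₁ , s₂ , s₃) = (t₁ ∧ s₁ , t₂ ∧ s₂ , t₃ ∧ s₃)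

bracketₗ : Three → Three → Three → LocalTriple
bracketₗ g h i = (u , v , v)
  where
    u = (h ==₃ r1) ∧ not ((g ==₃ r1) ∨ (i ==₃ r1))
    v = (h ==₃ r2) ∧ not ((g ==₃ r2) ∨ (i ==₃ r2))

-- The equality patterns (a = b, a = c, b = c) of three points of Fin k are transitive,
-- and when k = 2 (big = false) they cannot be pairwise distinct.
transitive₃ : Bool × Bool × Bool → Bool
transitive₃ (eab , eac , ebc) = (eab ∧ eac ⇒ ebc) ∧ (eab ∧ ebc ⇒ eac) ∧ (eac ∧ ebc ⇒ eab)

fitsIn : Bool → Bool × Bool × Bool → Bool
fitsIn big (eab , eac , ebc) = big ∨ eab ∨ eac ∨ ebc

transitive₃-intro : ∀ {eab eac ebc} → (T eab → T eac → T ebc) → (T eab → T ebc → T eac) →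
                    (T eac → T ebc → T eab) → T (transitive₃ (eab , eac , ebc))
transitive₃-intro {true}  {true}  {true}  _ _ _ = _
transitive₃-intro {true}  {true}  {false} f _ _ = f _ _
transitive₃-intro {true}  {false} {true}  _ g _ = g _ _
transitive₃-intro {true}  {false} {false} _ _ _ = _
transitive₃-intro {false} {true}  {true}  _ _ h = h _ _
transitive₃-intro {false} {true}  {false} _ _ _ = _
transitive₃-intro {false} {false} {_}     _ _ _ = _

transitive₃-== : ∀ {k} (a b c : Fin k) → T (transitive₃ (a == b , a == c , b == c))
transitive₃-== a b c = transitive₃-intro {a == b} {a == c} {b == c}
  (λ ab ac → ==-trans {a = b} {a} {c} (==-symᵀ {a = a} {b} ab) ac)
  (λ ab bc → ==-trans {a = a} {b} {c} ab bc)
  (λ ac bc → ==-trans {a = a} {c} {b} ac (==-symᵀ {a = b} {c} bc))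

fitsIn-== : ∀ {k} → 2 ≤ k → (a b c : Fin k) → T (fitsIn (2 <ᵇ k) (a == b , a == c , b == c))
fitsIn-== {ℕ.suc (ℕ.suc (ℕ.suc _))} _ _ _ _ = _
fitsIn-== {1} (s≤s ())
fitsIn-== {2} _ zero       zero       _          = _
fitsIn-== {2} _ zero       (suc zero) zero       = _
fitsIn-== {2} _ zero       (suc zero) (suc zero) = _
fitsIn-== {2} _ (suc zero) zero       zero       = _
fitsIn-== {2} _ (suc zero) zero       (suc zero) = _
fitsIn-== {2} _ (suc zero) (suc zero) _          = _

module ClosedForms (R : RawSemiring 0ℓ 0ℓ) (num : ℕ → RawSemiring.Carrier R) where
  open RawSemiring R

  [_] : Bool → Carrier
  [ b ] = num (if b then 1 else 0)

  -- ∑ over p of Ψ (a = p) (b = p) (c = p), from the equality pattern of a, b, c and the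
  -- number `outside` of the p different from all three
  sum₃ : Carrier → Bool → Bool → Bool → (Bool → Bool → Bool → Carrier) → Carrier
  sum₃ outside eab eac ebc Ψ =
    Ψ true eab eac + ([ not eab ] * Ψ false true ebc +
      ([ not ebc ] * ([ not eac ] * Ψ false false true) + outside * Ψ false false false))

  -- the number of v with Φ (rel x v) (rel y v) (rel z v), from the equality patterns of the
  -- blocks and of the positions of x, y, z
  relationSum : Carrier → Carrier → (Bool × Bool × Bool) → (Bool × Bool × Bool) →
                (Three → Three → Three → Bool) → Carrier
  relationSum outL outM (ab , ac , bc) (pab , pac , pbc) Φ =
    sum₃ outL ab ac bc λ ex ey ez → sum₃ outM pab pac pbc λ px py pz →
      [ Φ (relation ex px) (relation ey py) (relation ez pz) ]

  choose : Bool → Carrier → Carrier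
  choose b a = [ b ] * a + [ not b ]

  module _ (ℓ₋₁ m₋₁ m : Carrier) where

    weight : LocalTriple → Carrier
    weight (u , v , w) = choose u m₋₁ * choose v (ℓ₋₁ * m) * choose (w ∧ not v) m

    -- the coordinate's factor of δ_{h,l} k_[g,h,i] k_{τ∖i} k_{σ∖g} k_{τ∩σ}
    κ : Three → Three → Three → Three → LocalTriple → LocalTriple → Carrier
    κ g h i l t s =
      [ h ==₃ l ] * weight (bracketₗ g h i) * weight (t ∖ₗ i) * weight (s ∖ₗ g) * weight (t ∩ₗ s)

  κ-cong : ∀ {ℓ₋₁ ℓ₋₁′ m₋₁ m₋₁′ m m′} →
           ℓ₋₁ ≡ ℓ₋₁′ → m₋₁ ≡ m₋₁′ → m ≡ m′ →
           ∀ g h i l t s → κ ℓ₋₁ m₋₁ m g h i l t s ≡ κ ℓ₋₁′ m₋₁′ m′ g h i l t s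
  κ-cong ≡.refl ≡.refl ≡.refl g h i l t s = ≡.refl

module ℕCounting where
  open ℕSums
  open ClosedForms ℕ.+-*-rawSemiring id using (sum₃)
  open +-*-Solver using (solve; _:=_; con; _:+_; _:*_)

  #distinct : Bool × Bool × Bool → ℕ
  #distinct (eab , eac , ebc) = 1 ℕ.+ [ not eab ] ℕ.+ [ not ebc ] ℕ.* [ not eac ]

  #distinct≤3 : ∀ e → #distinct e ≤ 3
  #distinct≤3 (eab , eac , ebc) =
    +-mono-≤ (+-mono-≤ (≤-refl {1}) ([b]≤1 (not eab))) (*-mono-≤ ([b]≤1 (not ebc)) ([b]≤1 (not eac)))
    where
      [b]≤1 : ∀ b → [ b ] ≤ 1
      [b]≤1 true  = s≤s z≤n
      [b]≤1 false = z≤n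

  ∑-ones : ∀ k → ∑[ p < k ] 1 ≡ k
  ∑-ones ℕ.zero    = ≡.refl
  ∑-ones (ℕ.suc k) = ≡.cong ℕ.suc (∑-ones k)

  outside≡ : ∀ {k} (a b c : Fin k) → outside a b c ≡ k ∸ #distinct (a == b , a == c , b == c)
  outside≡ {k} a b c = ≡.sym (≡.trans (≡.cong (_∸ d) k≡d+o) (m+n∸m≡n d (outside a b c)))
    where
      d = #distinct (a == b , a == c , b == c)
      k≡d+o : k ≡ d ℕ.+ outside a b c
      k≡d+o = ≡.trans (≡.sym (∑-ones k)) (≡.trans (∑-three-points a b c (λ _ _ _ → 1))
        (solve 4 (λ x y z o → con 1 :+ (x :* con 1 :+ (y :* (z :* con 1) :+ o :* con 1)) := con 1 :+ x :+ y :* z :+ o)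
               ≡.refl [ not (a == b) ] [ not (b == c) ] [ not (a == c) ] (outside a b c)))

  ∑-three-points≡sum₃ : ∀ {k} (a b c : Fin k) (Ψ : Bool → Bool → Bool → ℕ) →
    ∑[ p < k ] Ψ (a == p) (b == p) (c == p) ≡
    sum₃ (k ∸ #distinct (a == b , a == c , b == c)) (a == b) (a == c) (b == c) Ψ
  ∑-three-points≡sum₃ a b c Ψ rewrite ≡.sym (outside≡ a b c) = ∑-three-points a b c Ψ

module Symbolic where
  open +-*-Solver public using (⟦_⟧)
  open +-*-Solver using (Polynomial; con; var; _:+_; _:*_; normalise; _≟N_; prove; ⟦_⟧N-cong)

  Poly : Set
  Poly = Polynomial 2

  polyRawSemiring : RawSemiring 0ℓ 0ℓ
  polyRawSemiring = record
    { Carrier = Poly ; _≈_ = _≡_ ; _+_ = _:+_ ; _*_ = _:*_ ; 0# = con 0 ; 1# = con 1 }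

  open ClosedForms polyRawSemiring con
  open ℕCounting using (#distinct)

  -- a size N ≥ 2 is 2 when ¬ big and 3 + X for a variable X when big; minusₚ is N ∸ k
  minusₚ : Bool → Fin 2 → ℕ → Poly
  minusₚ big v k = if big then con (3 ∸ k) :+ var v else con (2 ∸ k)

  ⟦minusₚ⟧ : ∀ {N} → 2 ≤ N → ∀ v (ρ : Vec ℕ 2) → lookup ρ v ≡ N ∸ 3 →
             ∀ {k} → k ≤ 3 → ⟦ minusₚ (2 <ᵇ N) v k ⟧ ρ ≡ N ∸ k
  ⟦minusₚ⟧ {2}                           _ v ρ _   _   = ≡.refl
  ⟦minusₚ⟧ {ℕ.suc (ℕ.suc (ℕ.suc N))} _ v ρ ρv≡N k≤3 =
    ≡.trans (≡.cong (_ ℕ.+_) ρv≡N) (≡.sym (+-∸-comm N k≤3))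
  ⟦minusₚ⟧ {1} (s≤s ())

  module _ (bigL bigM : Bool) (blocks positions : Bool × Bool × Bool) (h : Three) (t s : LocalTriple) where
    private
      ab = proj₁ blocks
      ac = proj₁ (proj₂ blocks)
      pab = proj₁ positions
      pac = proj₁ (proj₂ positions)
      g = relation ab pab
      i = relation ac pac
      ryz = relation (proj₂ (proj₂ blocks)) (proj₂ (proj₂ positions))

    -- the two sides of ∑-β∧β-aligned below, where g = rel x y, i = rel x z and l = h
    lhsₚ rhsₚ : Poly
    lhsₚ = relationSum (minusₚ bigL zero (#distinct blocks)) (minusₚ bigM (suc zero) (#distinct positions))
             blocks positions λ rxv ryv rzv → βₗ bigL bigM g h t g rxv ryv ∧ βₗ bigL bigM h i s rxv i rzv
    rhsₚ = κ (minusₚ bigL zero 1) (minusₚ bigM (suc zero) 1) (minusₚ bigM (suc zero) 0) g h i h t s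
             :* [ βₗ bigL bigM g i (combₗ bigL bigM g h i t s) g i ryz ]

  LocalIdentity : Set
  LocalIdentity =
    ∀ bigL bigM blocks positions h t s →
    T (transitive₃ blocks) → T (transitive₃ positions) →
    T (fitsIn bigL blocks) → T (fitsIn bigM positions) →
    T (inUₗ bigL bigM (relation (proj₁ blocks) (proj₁ positions)) h t) →
    T (inUₗ bigL bigM h (relation (proj₁ (proj₂ blocks)) (proj₁ (proj₂ positions))) s) →
    ∀ ρ → ⟦ lhsₚ bigL bigM blocks positions h t s ⟧ ρ ≡ ⟦ rhsₚ bigL bigM blocks positions h t s ⟧ ρ

  private
    ∀-Bool : {P : Bool → Set} → (∀ b → Maybe (P b)) → Maybe (∀ b → P b)
    ∀-Bool f with f true | f false
    ... | just p | just q = just λ { true → p ; false → q }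
    ... | _      | _      = nothing

    ∀-Three : {P : Three → Set} → (∀ a → Maybe (P a)) → Maybe (∀ a → P a)
    ∀-Three f with f r0 | f r1 | f r2
    ... | just p | just q | just r = just λ { r0 → p ; r1 → q ; r2 → r }
    ... | _      | _      | _      = nothing

    ∀-Bool³ : {P : Bool × Bool × Bool → Set} → (∀ a → Maybe (P a)) → Maybe (∀ a → P a)
    ∀-Bool³ f = Maybe.map (λ p (a , b , c) → p a b c) (∀-Bool λ a → ∀-Bool λ b → ∀-Bool λ c → f (a , b , c))

    samePolynomial : (p q : Poly) → Maybe (∀ ρ → ⟦ p ⟧ ρ ≡ ⟦ q ⟧ ρ)
    samePolynomial p q = Maybe.map (λ eq ρ → prove ρ p q (⟦ eq ⟧N-cong ρ)) (normalise p ≟N normalise q)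

    assuming : {P : Set} (b : Bool) → Maybe P → Maybe (T b → P)
    assuming false _ = just λ ()
    assuming true  m = Maybe.map (λ p _ → p) m

    decideLocalIdentity : Maybe LocalIdentity
    decideLocalIdentity =
      ∀-Bool λ bigL → ∀-Bool λ bigM → ∀-Bool³ λ blocks → ∀-Bool³ λ positions →
      ∀-Three λ h → ∀-Bool³ λ t → ∀-Bool³ λ s →
      assuming (transitive₃ blocks) (assuming (transitive₃ positions) (
      assuming (fitsIn bigL blocks) (assuming (fitsIn bigM positions) (
      assuming (inUₗ bigL bigM (relation (proj₁ blocks) (proj₁ positions)) h t) (
      assuming (inUₗ bigL bigM h (relation (proj₁ (proj₂ blocks)) (proj₁ (proj₂ positions))) s) (
      samePolynomial (lhsₚ bigL bigM blocks positions h t s) (rhsₚ bigL bigM blocks positions h t s)))))))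

  -- from-just makes the type checker run the finite check decideLocalIdentity
  localIdentity : LocalIdentity
  localIdentity = from-just decideLocalIdentity

module Local (L M : ℕ) where
  open ℕSums
  open ClosedForms ℕ.+-*-rawSemiring id using (sum₃; relationSum; κ-cong) renaming (κ to κ-form)
  open ℕCounting
  open Symbolic using (⟦_⟧; lhsₚ; rhsₚ; localIdentity; ⟦minusₚ⟧)
  open ≡.≡-Reasoning

  Point : Set
  Point = Fin L × Fin M

  points : List Point
  points = concatMap (λ b → map (b ,_) (allFin M)) (allFin L)

  rel : Point → Point → Three
  rel (b , p) (b′ , p′) = relation (b == b′) (p == p′)

  rel-sym : ∀ u v → rel u v ≡ rel v u
  rel-sym (b , p) (b′ , p′) = ≡.cong₂ relation (==-sym b b′) (==-sym p p′)

  blockPattern positionPattern : Point → Point → Point → Bool × Bool × Bool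
  blockPattern    (a , _) (b , _) (c , _) = (a == b , a == c , b == c)
  positionPattern (_ , a) (_ , b) (_ , c) = (a == b , a == c , b == c)

  ∑-relations : ∀ x y z (Φ : Three → Three → Three → Bool) →
    ∑ₗ points (λ v → [ Φ (rel x v) (rel y v) (rel z v) ]) ≡
    relationSum (L ∸ #distinct (blockPattern x y z)) (M ∸ #distinct (positionPattern x y z))
                (blockPattern x y z) (positionPattern x y z) Φ
  ∑-relations x@(xb , xp) y@(yb , yp) z@(zb , zp) Φ = begin
    ∑ₗ points F
      ≡⟨ ∑ₗ-grid F ⟩
    ∑[ b < L ] ∑[ p < M ] F (b , p)
      ≡⟨ sum-cong-≋ {L} (λ b → ∑-three-points≡sum₃ xp yp zp (Ψ (xb == b) (yb == b) (zb == b))) ⟩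
    ∑[ b < L ] inner (xb == b) (yb == b) (zb == b)
      ≡⟨ ∑-three-points≡sum₃ xb yb zb inner ⟩
    relationSum (L ∸ #distinct (blockPattern x y z)) outM (blockPattern x y z) (positionPattern x y z) Φ ∎
    where
      F = λ v → [ Φ (rel x v) (rel y v) (rel z v) ]
      Ψ : Bool → Bool → Bool → Bool → Bool → Bool → ℕ
      Ψ ex ey ez px py pz = [ Φ (relation ex px) (relation ey py) (relation ez pz) ]
      outM = M ∸ #distinct (positionPattern x y z)
      inner : Bool → Bool → Bool → ℕ
      inner ex ey ez = sum₃ outM (xp == yp) (xp == zp) (yp == zp) (Ψ ex ey ez)

  bigL bigM : Bool
  bigL = 2 <ᵇ L
  bigM = 2 <ᵇ M

  β : Three → Three → LocalTriple → Point → Point → Point → Bool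
  β g h t x u w = βₗ bigL bigM g h t (rel x u) (rel x w) (rel u w)

  β-vanishesˡ : ∀ g h t x u w → (rel x u ==₃ g) ≡ false → β g h t x u w ≡ false
  β-vanishesˡ g h t x u w = βₗ-vanishesˡ g h t (rel x u) (rel x w) (rel u w)

  β-vanishesʳ : ∀ g h t x u w → (rel x w ==₃ h) ≡ false → β g h t x u w ≡ false
  β-vanishesʳ g h t x u w = βₗ-vanishesʳ g h t (rel x u) (rel x w) (rel u w)

  κ : Three → Three → Three → Three → LocalTriple → LocalTriple → ℕ
  κ = κ-form (L ∸ 1) (M ∸ 1) M

  vanishing : ∀ {f : Point → ℕ} {r} → (∀ v → f v ≡ 0) → r ≡ 0 → ∑ₗ points f ≡ r
  vanishing f≡0 r≡0 = ≡.trans (∑ₗ-zero points f≡0) (≡.sym r≡0)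

  module _ (2≤L : 2 ≤ L) (2≤M : 2 ≤ M) where

    ∑-β∧β-aligned : ∀ x y z h t s → T (inUₗ bigL bigM (rel x y) h t) → T (inUₗ bigL bigM h (rel x z) s) →
      ∑ₗ points (λ v → [ β (rel x y) h t x y v ∧ β h (rel x z) s x v z ]) ≡
      κ (rel x y) h (rel x z) h t s ℕ.* [ β (rel x y) (rel x z) (combₗ bigL bigM (rel x y) h (rel x z) t s) x y z ]
    ∑-β∧β-aligned x@(xb , xp) y@(yb , yp) z@(zb , zp) h t s τ-local σ-local = begin
      ∑ₗ points (λ v → [ β g h t x y v ∧ β h i s x v z ])
        ≡⟨ ∑ₗ-cong points (λ v → ≡.cong (λ r → [ β g h t x y v ∧ βₗ bigL bigM h i s (rel x v) i r ])
                                        (rel-sym v z)) ⟩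
      ∑ₗ points (λ v → [ Φ (rel x v) (rel y v) (rel z v) ])
        ≡⟨ ∑-relations x y z Φ ⟩
      relationSum (L ∸ #distinct bp) (M ∸ #distinct pp) bp pp Φ
        ≡⟨ ≡.cong₂ (λ oL oM → relationSum oL oM bp pp Φ) (L-minus (#distinct≤3 bp)) (M-minus (#distinct≤3 pp)) ⟨
      ⟦ lhsₚ bigL bigM bp pp h t s ⟧ ρ
        ≡⟨ localIdentity bigL bigM bp pp h t s (transitive₃-== xb yb zb) (transitive₃-== xp yp zp)
             (fitsIn-== 2≤L xb yb zb) (fitsIn-== 2≤M xp yp zp) τ-local σ-local ρ ⟩
      ⟦ rhsₚ bigL bigM bp pp h t s ⟧ ρ
        ≡⟨ ≡.cong (ℕ._* [ β g i (combₗ bigL bigM g h i t s) x y z ])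
             (κ-cong (L-minus (s≤s z≤n)) (M-minus (s≤s z≤n)) (M-minus z≤n) g h i h t s) ⟩
      κ g h i h t s ℕ.* [ β g i (combₗ bigL bigM g h i t s) x y z ] ∎
      where
        g = rel x y
        i = rel x z
        bp = blockPattern x y z
        pp = positionPattern x y z
        ρ = (L ∸ 3) ∷ (M ∸ 3) ∷ []
        L-minus = ⟦minusₚ⟧ 2≤L zero ρ ≡.refl
        M-minus = ⟦minusₚ⟧ 2≤M (suc zero) ρ ≡.refl
        Φ : Three → Three → Three → Bool
        Φ rxv ryv rzv = βₗ bigL bigM g h t g rxv ryv ∧ βₗ bigL bigM h i s rxv i rzv

    -- outside the aligned case both sides vanish, since β g h t x u w forces rel x u = g and rel x w = h
    ∑-β∧β : ∀ x y z g h i l t s → T (inUₗ bigL bigM g h t) → T (inUₗ bigL bigM l i s) →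
      ∑ₗ points (λ v → [ β g h t x y v ∧ β l i s x v z ]) ≡
      κ g h i l t s ℕ.* [ β g i (combₗ bigL bigM g h i t s) x y z ]
    ∑-β∧β x y z g h i l t s τ-local σ-local with g ≟₃ rel x y | i ≟₃ rel x z | l ≟₃ h
    ... | yes ≡.refl | yes ≡.refl | yes ≡.refl = ∑-β∧β-aligned x y z h t s τ-local σ-local
    ... | no g≢ | _ | _ = vanishing
      (λ v → ≡.cong (λ b → [ b ∧ β l i s x v z ]) (β-vanishesˡ g h t x y v rxy≠g))
      (≡.trans (≡.cong (λ b → κ g h i l t s ℕ.* [ b ]) (β-vanishesˡ g i _ x y z rxy≠g)) (*-zeroʳ (κ g h i l t s)))
      where rxy≠g = ==₃-≢ (g≢ ∘ ≡.sym)
    ... | yes _ | no i≢ | _ = vanishing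
      (λ v → ≡.trans (≡.cong (λ b → [ β g h t x y v ∧ b ]) (β-vanishesʳ l i s x v z rxz≠i)) (≡.cong [_] (∧-zeroʳ _)))
      (≡.trans (≡.cong (λ b → κ g h i l t s ℕ.* [ b ]) (β-vanishesʳ g i _ x y z rxz≠i)) (*-zeroʳ (κ g h i l t s)))
      where rxz≠i = ==₃-≢ (i≢ ∘ ≡.sym)
    ... | yes _ | yes _ | no l≢h = vanishing
      (λ v → ≡.cong [_] (summand-vanishes v (l≢h ∘ ≡.sym)))
      (≡.cong (ℕ._* [ β g i (combₗ bigL bigM g h i t s) x y z ]) (κ-vanishes (==₃-≢ (l≢h ∘ ≡.sym))))
      where
        summand-vanishes : ∀ v → h ≢ l → (β g h t x y v ∧ β l i s x v z) ≡ false
        summand-vanishes v h≢l with rel x v ≟₃ h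
        ... | yes ≡.refl = ≡.trans (≡.cong (β g h t x y v ∧_) (β-vanishesˡ l i s x v z (==₃-≢ h≢l))) (∧-zeroʳ _)
        ... | no r≢h     = ≡.cong (_∧ β l i s x v z) (β-vanishesʳ g h t x y v (==₃-≢ r≢h))
        κ-vanishes : (h ==₃ l) ≡ false → κ g h i l t s ≡ 0
        κ-vanishes e rewrite e = ≡.refl

module Tensor {c ℓ′} (F : Field c ℓ′) (n : ℕ) (ℓ m : Fin n → ℕ) where
  open Field F hiding (zero)
  open Setup F n ℓ m hiding (_∘)
  module S = Setup F n ℓ m
  open Sums commutativeSemiring
  import Algebra.Properties.CommutativeMonoid.Sum *-commutativeMonoid as Π
  open import Algebra.Properties.Semiring.Mult semiring using (×1-homo-*)
  open import Algebra.Properties.Monoid.Mult +-monoid using (×-homo-+)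
  open import Algebra.Definitions.RawMonoid +-rawMonoid using () renaming (_×_ to _·_)
  open import Algebra.Properties.CommutativeSemigroup *-commutativeSemigroup using (x∙yz≈y∙xz)
  open import Relation.Binary.Reasoning.Setoid setoid

  private
    ι≡× : ∀ k → ι k ≡ k · 1#
    ι≡× ℕ.zero    = ≡.refl
    ι≡× (ℕ.suc k) = ≡.cong (1# +_) (ι≡× k)

  ι-+ : ∀ a b → ι (a ℕ.+ b) ≈ ι a + ι b
  ι-+ a b rewrite ι≡× (a ℕ.+ b) | ι≡× a | ι≡× b = ×-homo-+ 1# a b

  ι-* : ∀ a b → ι (a ℕ.* b) ≈ ι a * ι b
  ι-* a b rewrite ι≡× (a ℕ.* b) | ι≡× a | ι≡× b = ×1-homo-* a b

  ι-[_] : ∀ b → ι ℕSums.[ b ] ≈ [ b ]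
  ι-[ true  ] = +-identityʳ 1#
  ι-[ false ] = refl

  ι-∑ₗ : ∀ {a} {A : Set a} (xs : List A) (f : A → ℕ) → ι (ℕSums.∑ₗ xs f) ≈ ∑ₗ xs (ι ∘ f)
  ι-∑ₗ []       f = refl
  ι-∑ₗ (x ∷ xs) f = trans (ι-+ (f x) _) (+-congˡ (ι-∑ₗ xs f))

  product : (Fin n → Carrier) → Carrier
  product = Π.sum

  product-cong : ∀ {f g : Fin n → Carrier} → (∀ j → f j ≈ g j) → product f ≈ product g
  product-cong = Π.sum-cong-≋

  product-* : ∀ (f g : Fin n → Carrier) → product f * product g ≈ product (λ j → f j * g j)
  product-* f g = sym (Π.∑-distrib-+ f g)

  [all] : ∀ {a} {A : Set a} {k} (g : Fin k → A) (p : A → Bool) → [ all p (tabulate g) ] ≈ Π.sum (λ j → [ p (g j) ])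
  [all] {k = ℕ.zero}  g p = refl
  [all] {k = ℕ.suc k} g p = trans ([∧] (p (g zero)) _) (*-congˡ ([all] (λ j → g (suc j)) p))

  [allB] : ∀ p → [ allB p ] ≈ product (λ j → [ p j ])
  [allB] = [all] {k = n} (λ j → j)

  ι-∏ : ∀ V f → ι (∏ V f) ≈ product (λ j → ι (if lookup V j then f j else 1))
  ι-∏ V f = go (λ j → j)
    where
      go : ∀ {k} (g : Fin k → Fin n) →
           ι (foldr (λ j r → (if lookup V j then f j else 1) ℕ.* r) 1 (tabulate g)) ≈
           Π.sum (λ j → ι (if lookup V (g j) then f (g j) else 1))
      go {ℕ.zero}  g = +-identityʳ 1#
      go {ℕ.suc k} g = trans (ι-* (if lookup V (g zero) then f (g zero) else 1) _) (*-congˡ (go (λ j → g (suc j))))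

  [⊆ᵇ] : ∀ {k} (P Q : Subset k) → [ isYes (P ⊆? Q) ] ≈ Π.sum (λ j → [ lookup P j ⇒ lookup Q j ])
  [⊆ᵇ] []          []           = refl
  [⊆ᵇ] (false ∷ P) (_ ∷ Q)      with P ⊆? Q | [⊆ᵇ] P Q
  ... | yes _ | P⊆Q = trans P⊆Q (sym (*-identityˡ _))
  ... | no  _ | P⊆Q = trans P⊆Q (sym (*-identityˡ _))
  [⊆ᵇ] (true  ∷ P) (false ∷ Q)  = sym (zeroˡ _)
  [⊆ᵇ] (true  ∷ P) (true  ∷ Q)  with P ⊆? Q | [⊆ᵇ] P Q
  ... | yes _ | P⊆Q = trans P⊆Q (sym (*-identityˡ _))
  ... | no  _ | P⊆Q = trans P⊆Q (sym (*-identityˡ _))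

  LocalMatrix : Fin n → Set c
  LocalMatrix j = U j → U j → Carrier

  ⨂ : ((j : Fin n) → LocalMatrix j) → Mat
  ⨂ f a b = product (λ j → f j (a j) (b j))

  _⊙_ : ∀ {j} → LocalMatrix j → LocalMatrix j → LocalMatrix j
  _⊙_ {j} p q u w = ∑ₗ (allU j) (λ v → p u v * q v w)

  ∑-enum : ∀ k (A : Fin k → Set) (L : (i : Fin k) → List (A i)) (f : (i : Fin k) → A i → Carrier) →
           ∑ₗ (enum k A L) (λ u → Π.sum (λ i → f i (u i))) ≈ Π.sum (λ i → ∑ₗ (L i) (f i))
  ∑-enum ℕ.zero    A L f = +-identityʳ 1#
  ∑-enum (ℕ.suc k) A L f = begin
    ∑ₗ (concatMap (λ a → map (consF {A = A} a) rest) (L zero)) G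
      ≈⟨ ∑ₗ-concatMap _ (L zero) G ⟩
    ∑ₗ (L zero) (λ a → ∑ₗ (map (consF {A = A} a) rest) G)
      ≈⟨ ∑ₗ-cong (L zero) (λ a → reflexive (∑ₗ-map (consF {A = A} a) rest G)) ⟩
    ∑ₗ (L zero) (λ a → ∑ₗ rest (λ u → f zero a * Rest u))
      ≈⟨ ∑ₗ-cong (L zero) (λ a → sym (*-distribˡ-∑ₗ (f zero a) rest Rest)) ⟩
    ∑ₗ (L zero) (λ a → f zero a * ∑ₗ rest Rest)
      ≈⟨ ∑ₗ-cong (L zero) (λ a → *-congˡ (∑-enum k (λ i → A (suc i)) (λ i → L (suc i)) (λ i → f (suc i)))) ⟩
    ∑ₗ (L zero) (λ a → f zero a * Π.sum (λ i → ∑ₗ (L (suc i)) (f (suc i))))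
      ≈⟨ sym (*-distribʳ-∑ₗ _ (L zero) (f zero)) ⟩
    ∑ₗ (L zero) (f zero) * Π.sum (λ i → ∑ₗ (L (suc i)) (f (suc i))) ∎
    where
      rest = enum k (λ i → A (suc i)) (λ i → L (suc i))
      G = λ u → Π.sum (λ i → f i (u i))
      Rest = λ u → Π.sum (λ i → f (suc i) (u i))

  *M-⨂ : ∀ {M₁ M₂} p q → M₁ ≈M ⨂ p → M₂ ≈M ⨂ q → (M₁ *M M₂) ≈M ⨂ (λ j → p j ⊙ q j)
  *M-⨂ {M₁} {M₂} p q M₁≈ M₂≈ a b = begin
    ∑ₗ allX (λ z → M₁ a z * M₂ z b)
      ≈⟨ ∑ₗ-cong allX (λ z → trans (*-cong (M₁≈ a z) (M₂≈ z b))
                                    (product-* (λ j → p j (a j) (z j)) (λ j → q j (z j) (b j)))) ⟩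
    ∑ₗ allX (λ z → product (λ j → p j (a j) (z j) * q j (z j) (b j)))
      ≈⟨ ∑-enum n U allU (λ j v → p j (a j) v * q j v (b j)) ⟩
    ⨂ (λ j → p j ⊙ q j) a b ∎

  _at_ : Triple → (j : Fin n) → LocalTriple
  (J₁ , J₂ , J₃) at j = (lookup J₁ j , lookup J₂ j , lookup J₃ j)

  bigL bigM : Fin n → Bool
  bigL j = 2 <ᵇ ℓ j
  bigM j = 2 <ᵇ m j

  S-at : ∀ r g j → lookup (S r g) j ≡ (g j ==₃ r)
  S-at r g j = lookup∘tabulate _ j

  module _ {j : Fin n} where

    ∩-at : ∀ P Q {a b} → lookup P j ≡ a → lookup Q j ≡ b → lookup (P ∩ Q) j ≡ (a ∧ b)
    ∩-at P Q ≡.refl ≡.refl = lookup-zipWith _∧_ j P Q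

    ∪-at : ∀ P Q {a b} → lookup P j ≡ a → lookup Q j ≡ b → lookup (P ∪ Q) j ≡ (a ∨ b)
    ∪-at P Q ≡.refl ≡.refl = lookup-zipWith _∨_ j P Q

    ─-at : ∀ P Q {a b} → lookup P j ≡ a → lookup Q j ≡ b → lookup (P ─ Q) j ≡ (a ∧ not b)
    ─-at P Q ≡.refl ≡.refl = lookup-─ P Q j
      where
        lookup-─ : ∀ {k} (P Q : Subset k) j → lookup (P ─ Q) j ≡ (lookup P j ∧ not (lookup Q j))
        lookup-─ (a ∷ P) (true  ∷ Q) zero    = ≡.sym (∧-zeroʳ a)
        lookup-─ (a ∷ P) (false ∷ Q) zero    = ≡.sym (∧-identityʳ a)
        lookup-─ (_ ∷ P) (_     ∷ Q) (suc j) = lookup-─ P Q j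

    •-at : ∀ V {a} → lookup V j ≡ a → lookup (V •) j ≡ (a ∧ bigL j)
    •-at V ≡.refl = lookup∘tabulate _ j

    ∘-at : ∀ V {a} → lookup V j ≡ a → lookup (V S.∘) j ≡ (a ∧ bigM j)
    ∘-at V ≡.refl = lookup∘tabulate _ j

    ⊆-at : ∀ {P Q : Subset n} {b} → P ⊆ Q → lookup Q j ≡ b → (lookup P j ⇒ b) ≡ true
    ⊆-at {P} {Q} P⊆Q ≡.refl with lookup P j in P[j]
    ... | false = ≡.refl
    ... | true  = []=⇒lookup (P⊆Q (lookup⇒[]= j P P[j]))

  module _ (g : E) (j : Fin n) where

    S∩S-at : ∀ r h → lookup (S r g ∩ S r h) j ≡ ((g j ==₃ r) ∧ (h j ==₃ r))
    S∩S-at r h = ∩-at (S r g) (S r h) (S-at r g j) (S-at r h j)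

    S─S∪S-at : ∀ r h i → lookup (S r h ─ (S r g ∪ S r i)) j ≡ ((h j ==₃ r) ∧ not ((g j ==₃ r) ∨ (i j ==₃ r)))
    S─S∪S-at r h i = ─-at (S r h) (S r g ∪ S r i) (S-at r h j) (∪-at (S r g) (S r i) (S-at r g j) (S-at r i j))

  ∖-at : ∀ τ g j → (τ ∖ g) at j ≡ (τ at j) ∖ₗ g j
  ∖-at (J₁ , J₂ , J₃) g j = ≡.cong₂ _,_ (─-at J₁ (S r1 g) ≡.refl (S-at r1 g j))
    (≡.cong₂ _,_ (─-at J₂ (S r2 g) ≡.refl (S-at r2 g j)) (─-at J₃ (S r2 g) ≡.refl (S-at r2 g j)))

  ∩T-at : ∀ τ σ j → (τ ∩T σ) at j ≡ (τ at j) ∩ₗ (σ at j)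
  ∩T-at (J₁ , J₂ , J₃) (K₁ , K₂ , K₃) j = ≡.cong₂ _,_ (∩-at J₁ K₁ ≡.refl ≡.refl)
    (≡.cong₂ _,_ (∩-at J₂ K₂ ≡.refl ≡.refl) (∩-at J₃ K₃ ≡.refl ≡.refl))

  comb-at : ∀ g h i τ σ j →
    comb g h i τ σ at j ≡ combₗ (bigL j) (bigM j) (g j) (h j) (i j) (τ at j) (σ at j)
  comb-at g h i (J₁ , J₂ , J₃) (K₁ , K₂ , K₃) j = ≡.cong₂ _,_
    (∪-at ((gi r1 S.∘) ─ S r1 h) (S r1 g ∩ S r1 i ∩ (J₁ ∪ K₁))
          (─-at (gi r1 S.∘) (S r1 h) (∘-at (gi r1) (S∩S-at g j r1 i)) (S-at r1 h j)) (both r1 J₁ K₁)) (≡.cong₂ _,_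
    (∪-at ((gi r2 •) ─ S r2 h) (S r2 g ∩ S r2 i ∩ (J₂ ∪ K₂))
          (─-at (gi r2 •) (S r2 h) (•-at (gi r2) (S∩S-at g j r2 i)) (S-at r2 h j)) (both r2 J₂ K₂))
    (∪-at (gi r2 ─ S r2 h) (S r2 g ∩ S r2 i ∩ (J₃ ∪ K₃))
          (─-at (gi r2) (S r2 h) (S∩S-at g j r2 i) (S-at r2 h j)) (both r2 J₃ K₃)))
    where
      gi : Three → Subset n
      gi r = S r g ∩ S r i
      both : ∀ r J K → lookup (S r g ∩ S r i ∩ (J ∪ K)) j ≡ ((g j ==₃ r) ∧ (i j ==₃ r) ∧ (lookup J j ∨ lookup K j))
      both r J K = ∩-at (S r g) (S r i ∩ (J ∪ K)) (S-at r g j)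
                        (∩-at (S r i) (J ∪ K) (S-at r i j) (∪-at J K ≡.refl ≡.refl))

  bracket : E → E → E → Triple
  bracket g h i = (S r1 h ─ (S r1 g ∪ S r1 i) , S r2 h ─ (S r2 g ∪ S r2 i) , S r2 h ─ (S r2 g ∪ S r2 i))

  bracket-at : ∀ g h i j → bracket g h i at j ≡ bracketₗ (g j) (h j) (i j)
  bracket-at g h i j = ≡.cong₂ _,_ (S─S∪S-at g j r1 h i) (≡.cong₂ _,_ (S─S∪S-at g j r2 h i) (S─S∪S-at g j r2 h i))

  InU-at : ∀ g h τ → InU g h τ → ∀ j → T (inUₗ (bigL j) (bigM j) (g j) (h j) (τ at j))
  InU-at g h τ (J₁⊆ , J₂⊆ , J₂⊆J₃ , J₃⊆) j = Equivalence.from T-≡ (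
    ≡.cong₂ _∧_ (⊆-at {j} J₁⊆ (∘-at (S r1 g ∩ S r1 h) (S∩S-at g j r1 h))) (≡.cong₂ _∧_
                (⊆-at {j} J₂⊆ (•-at (S r2 g ∩ S r2 h) (S∩S-at g j r2 h))) (≡.cong₂ _∧_
                (⊆-at {j} J₂⊆J₃ ≡.refl)
                (⊆-at {j} J₃⊆ (S∩S-at g j r2 h)))))

  ⨂-cong : ∀ {p q : (j : Fin n) → LocalMatrix j} → (∀ j u w → p j u w ≈ q j u w) → ⨂ p ≈M ⨂ q
  ⨂-cong p≈q a b = product-cong (λ j → p≈q j (a j) (b j))

  relU≡rel : ∀ j u w → relU j u w ≡ Local.rel (ℓ j) (m j) u w
  relU≡rel j (b , p) (b′ , p′) with b ≟ b′ | p ≟ p′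
  ... | yes ≡.refl | yes ≡.refl rewrite ==-refl b | ==-refl p = ≡.refl
  ... | yes ≡.refl | no p≢p′    rewrite ==-refl b | ==-≢ p≢p′ = ≡.refl
  ... | no b≢b′    | _          rewrite ==-≢ b≢b′ = ≡.refl

  _≐_ : ∀ {j} → U j → U j → Bool
  (b , p) ≐ (b′ , p′) = (b == b′) ∧ (p == p′)

  ≐-sym : ∀ {j} (u v : U j) → (u ≐ v) ≡ (v ≐ u)
  ≐-sym (b , p) (b′ , p′) = ≡.cong₂ _∧_ (==-sym b b′) (==-sym p p′)

  ∑-diag : ∀ j (u : U j) (f : U j → Carrier) → ∑ₗ (allU j) (λ v → [ u ≐ v ] * f v) ≈ f u
  ∑-diag j (b₀ , p₀) f = begin
    ∑ₗ (allU j) (λ v → [ (b₀ , p₀) ≐ v ] * f v)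
      ≈⟨ ∑ₗ-grid {ℓ j} {m j} (λ v → [ (b₀ , p₀) ≐ v ] * f v) ⟩
    ∑[ b < ℓ j ] ∑[ p < m j ] ([ (b₀ == b) ∧ (p₀ == p) ] * f (b , p))
      ≈⟨ sum-cong-≋ {ℓ j} (λ b → sum-cong-≋ {m j} (λ p →
           trans (*-congʳ ([∧] (b₀ == b) (p₀ == p))) (*-assoc _ _ _))) ⟩
    ∑[ b < ℓ j ] ∑[ p < m j ] ([ b₀ == b ] * ([ p₀ == p ] * f (b , p)))
      ≈⟨ sum-cong-≋ {ℓ j} (λ b → sym (*-distribˡ-sum {m j} [ b₀ == b ] _)) ⟩
    ∑[ b < ℓ j ] ([ b₀ == b ] * ∑[ p < m j ] ([ p₀ == p ] * f (b , p)))
      ≈⟨ ∑-delta b₀ _ ⟩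
    ∑[ p < m j ] ([ p₀ == p ] * f (b₀ , p))
      ≈⟨ ∑-delta p₀ _ ⟩
    f (b₀ , p₀) ∎

  weight : (j : Fin n) → LocalTriple → ℕ
  weight j = ClosedForms.weight ℕ.+-*-rawSemiring id (ℓ j ∸ 1) (m j ∸ 1) (m j)

  choice : Bool → ℕ → ℕ
  choice b k = if b then k else 1

  ι-weight : ∀ j u v w → ι (weight j (u , v , w)) ≈
             ι (choice u (m j ∸ 1)) * ι (choice v ((ℓ j ∸ 1) ℕ.* m j)) * ι (choice (w ∧ not v) (m j))
  ι-weight j u v w = begin
    ι (c₁ ℕ.* c₂ ℕ.* c₃) ≈⟨ trans (ι-* (c₁ ℕ.* c₂) c₃) (*-congʳ (ι-* c₁ c₂)) ⟩
    ι c₁ * ι c₂ * ι c₃   ≈⟨ *-cong (*-cong (ι-choose u _) (ι-choose v _)) (ι-choose (w ∧ not v) _) ⟩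
    ι (choice u (m j ∸ 1)) * ι (choice v ((ℓ j ∸ 1) ℕ.* m j)) * ι (choice (w ∧ not v) (m j)) ∎
    where
      choose = ClosedForms.choose ℕ.+-*-rawSemiring id
      c₁ = choose u (m j ∸ 1)
      c₂ = choose v ((ℓ j ∸ 1) ℕ.* m j)
      c₃ = choose (w ∧ not v) (m j)
      ι-choose : ∀ b k → ι (choose b k) ≈ ι (choice b k)
      ι-choose true  k = reflexive (≡.cong ι (≡.trans (ℕₚ.+-identityʳ _) (ℕₚ.+-identityʳ k)))
      ι-choose false k = refl

  ι-kT : ∀ τ → ι (kT τ) ≈ product (λ j → ι (weight j (τ at j)))
  ι-kT (J₁ , J₂ , J₃) = begin
    ι (P₁ ℕ.* P₂ ℕ.* P₃)
      ≈⟨ trans (ι-* (P₁ ℕ.* P₂) P₃) (*-congʳ (ι-* P₁ P₂)) ⟩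
    ι P₁ * ι P₂ * ι P₃
      ≈⟨ *-cong (*-cong (ι-∏ J₁ _) (ι-∏ J₂ _)) (ι-∏ (J₃ ─ J₂) m) ⟩
    product _ * product _ * product _
      ≈⟨ trans (*-congʳ (product-* _ _)) (product-* _ _) ⟩
    product (λ j → ι (choice (t₁ j) (m j ∸ 1)) * ι (choice (t₂ j) ((ℓ j ∸ 1) ℕ.* m j)) *
                   ι (choice (lookup (J₃ ─ J₂) j) (m j)))
      ≈⟨ product-cong (λ j → sym (trans (ι-weight j (t₁ j) (t₂ j) (t₃ j))
           (reflexive (≡.cong (λ b → ι (choice (t₁ j) (m j ∸ 1)) * ι (choice (t₂ j) ((ℓ j ∸ 1) ℕ.* m j)) * ι (choice b (m j)))
                               (≡.sym (─-at J₃ J₂ ≡.refl ≡.refl)))))) ⟩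
    product (λ j → ι (weight j (t₁ j , t₂ j , t₃ j))) ∎
    where
      P₁ = ∏ J₁ (λ j → m j ∸ 1)
      P₂ = ∏ J₂ (λ j → (ℓ j ∸ 1) ℕ.* m j)
      P₃ = ∏ (J₃ ─ J₂) m
      t₁ = lookup J₁
      t₂ = lookup J₂
      t₃ = lookup J₃

  admissibleAt : E → E → Triple → (j : Fin n) → Three → Bool
  admissibleAt g h τ j = admissibleₗ (bigL j) (bigM j) (g j) (h j) (τ at j)

  κ : E → E → E → E → Triple → Triple → Fin n → ℕ
  κ g h i l τ σ j = Local.κ (ℓ j) (m j) (g j) (h j) (i j) (l j) (τ at j) (σ at j)

  ι-κ : ∀ g h i l τ σ j → ι (κ g h i l τ σ j) ≈
        [ h j ==₃ l j ] * ι (weight j (bracket g h i at j)) * ι (weight j ((τ ∖ i) at j)) *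
        ι (weight j ((σ ∖ g) at j)) * ι (weight j ((τ ∩T σ) at j))
  ι-κ g h i l τ σ j = begin
    ι (d ℕ.* w₀ ℕ.* w₁ ℕ.* w₂ ℕ.* w₃)
      ≈⟨ trans (ι-* (d ℕ.* w₀ ℕ.* w₁ ℕ.* w₂) w₃) (*-congʳ (trans (ι-* (d ℕ.* w₀ ℕ.* w₁) w₂)
           (*-congʳ (trans (ι-* (d ℕ.* w₀) w₁) (*-congʳ (ι-* d w₀)))))) ⟩
    ι d * ι w₀ * ι w₁ * ι w₂ * ι w₃
      ≈⟨ *-congʳ (*-congʳ (*-congʳ (*-congʳ ι-[ h j ==₃ l j ]))) ⟩
    [ h j ==₃ l j ] * ι w₀ * ι w₁ * ι w₂ * ι w₃
      ≡⟨ ≡.cong₂ (λ t₀ t₁ → [ h j ==₃ l j ] * ι (weight j t₀) * ι (weight j t₁) * ι w₂ * ι w₃)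
           (≡.sym (bracket-at g h i j)) (≡.sym (∖-at τ i j)) ⟩
    [ h j ==₃ l j ] * ι (weight j (bracket g h i at j)) * ι (weight j ((τ ∖ i) at j)) * ι w₂ * ι w₃
      ≡⟨ ≡.cong₂ (λ t₂ t₃ → _ * ι (weight j t₂) * ι (weight j t₃)) (≡.sym (∖-at σ g j)) (≡.sym (∩T-at τ σ j)) ⟩
    [ h j ==₃ l j ] * ι (weight j (bracket g h i at j)) * ι (weight j ((τ ∖ i) at j)) *
    ι (weight j ((σ ∖ g) at j)) * ι (weight j ((τ ∩T σ) at j)) ∎
    where
      d  = ℕSums.[ h j ==₃ l j ]
      w₀ = weight j (bracketₗ (g j) (h j) (i j))
      w₁ = weight j ((τ at j) ∖ₗ i j)
      w₂ = weight j ((σ at j) ∖ₗ g j)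
      w₃ = weight j ((τ at j) ∩ₗ (σ at j))

  scalar-⨂ : ∀ g h i l τ σ →
    δ h l * ι k[ g , h , i ] * ι (kT (τ ∖ i)) * ι (kT (σ ∖ g)) * ι (kT (τ ∩T σ)) ≈
    product (λ j → ι (κ g h i l τ σ j))
  scalar-⨂ g h i l τ σ = begin
    δ h l * ι (kT (bracket g h i)) * ι (kT (τ ∖ i)) * ι (kT (σ ∖ g)) * ι (kT (τ ∩T σ))
      ≈⟨ *-cong (*-cong (*-cong (*-cong ([allB] _) (ι-kT (bracket g h i))) (ι-kT (τ ∖ i))) (ι-kT (σ ∖ g)))
                (ι-kT (τ ∩T σ)) ⟩
    product D * product W₀ * product W₁ * product W₂ * product W₃
      ≈⟨ trans (*-congʳ (trans (*-congʳ (trans (*-congʳ (product-* D W₀)) (product-* _ W₁))) (product-* _ W₂)))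
               (product-* _ W₃) ⟩
    product (λ j → D j * W₀ j * W₁ j * W₂ j * W₃ j)
      ≈⟨ product-cong (λ j → sym (ι-κ g h i l τ σ j)) ⟩
    product (λ j → ι (κ g h i l τ σ j)) ∎
    where
      D  = λ j → [ h j ==₃ l j ]
      W₀ = λ j → ι (weight j (bracket g h i at j))
      W₁ = λ j → ι (weight j ((τ ∖ i) at j))
      W₂ = λ j → ι (weight j ((σ ∖ g) at j))
      W₃ = λ j → ι (weight j ((τ ∩T σ) at j))

  module AtBase (x : X) where
    open Base x

    E*ₗ : E → (j : Fin n) → LocalMatrix j
    E*ₗ g j u w = [ u ≐ w ] * [ relU j (x j) u ==₃ g j ]

    E*-⨂ : ∀ g → E* g ≈M ⨂ (E*ₗ g)
    E*-⨂ g a b = begin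
      [ (a =X b) ∧ R g x a ]
        ≈⟨ [∧] (a =X b) (R g x a) ⟩
      [ a =X b ] * [ R g x a ]
        ≈⟨ *-cong ([allB] _) ([allB] _) ⟩
      product (λ j → [ same j ]) * product G
        ≈⟨ product-* _ _ ⟩
      product (λ j → [ same j ] * G j)
        ≈⟨ product-cong (λ j → reflexive (≡.cong (λ e → [ e ] * G j) (same≡≐ j))) ⟩
      ⨂ (E*ₗ g) a b ∎
      where
        same : Fin n → Bool
        same j = isYes (proj₁ (a j) ≟ proj₁ (b j)) ∧ isYes (proj₂ (a j) ≟ proj₂ (b j))
        same≡≐ : ∀ j → same j ≡ (a j ≐ b j)
        same≡≐ j = ≡.cong₂ _∧_ (isYes-≟ (proj₁ (a j)) (proj₁ (b j))) (isYes-≟ (proj₂ (a j)) (proj₂ (b j)))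
        G = λ j → [ relU j (x j) (a j) ==₃ g j ]

    Aₗ : E → (j : Fin n) → LocalMatrix j
    Aₗ a j u w = [ relU j u w ==₃ a j ]

    A-⨂ : ∀ a → A a ≈M ⨂ (Aₗ a)
    A-⨂ a u w = [allB] _

    -- the coordinate-j factor of E*_g A_a E*_h, where t = a_j
    triangle : E → E → (j : Fin n) → Three → LocalMatrix j
    triangle g h j t u w = [ relU j (x j) u ==₃ g j ] * ([ relU j u w ==₃ t ] * [ relU j (x j) w ==₃ h j ])

    summand : E → E → E → Mat
    summand g h a = (E* g *M A a) *M E* h

    E*A-⨂ : ∀ g a → (E* g *M A a) ≈M ⨂ (λ j u w → [ relU j (x j) u ==₃ g j ] * Aₗ a j u w)
    E*A-⨂ g a y w = trans (*M-⨂ (E*ₗ g) (Aₗ a) (E*-⨂ g) (A-⨂ a) y w) (⨂-cong diag y w)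
      where
        diag : ∀ j u w → (E*ₗ g j ⊙ Aₗ a j) u w ≈ [ relU j (x j) u ==₃ g j ] * Aₗ a j u w
        diag j u w = trans (∑ₗ-cong (allU j) (λ v → *-assoc _ _ _))
                           (∑-diag j u (λ v → [ relU j (x j) u ==₃ g j ] * Aₗ a j v w))

    summand-⨂ : ∀ g h a → summand g h a ≈M ⨂ (λ j → triangle g h j (a j))
    summand-⨂ g h a y w = trans (*M-⨂ E*Aₗ (E*ₗ h) (E*A-⨂ g a) (E*-⨂ h) y w) (⨂-cong diag y w)
      where
        E*Aₗ : (j : Fin n) → LocalMatrix j
        E*Aₗ j u w = [ relU j (x j) u ==₃ g j ] * Aₗ a j u w
        diag : ∀ j u w → (E*Aₗ j ⊙ E*ₗ h j) u w ≈ triangle g h j (a j) u w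
        diag j u w = begin
          ∑ₗ (allU j) (λ v → E*Aₗ j u v * ([ v ≐ w ] * H v))
            ≈⟨ ∑ₗ-cong (allU j) (λ v → trans (x∙yz≈y∙xz _ _ _) (*-congʳ (reflexive (≡.cong [_] (≐-sym v w))))) ⟩
          ∑ₗ (allU j) (λ v → [ w ≐ v ] * (E*Aₗ j u v * H v))
            ≈⟨ ∑-diag j w (λ v → E*Aₗ j u v * H v) ⟩
          E*Aₗ j u w * H w
            ≈⟨ *-assoc _ _ _ ⟩
          triangle g h j (a j) u w ∎
          where
            H = λ v → [ relU j (x j) v ==₃ h j ]

    [triangles] : ∀ g h a y w → [ R g x y ∧ (R a y w ∧ R h x w) ] ≈ ⨂ (λ j → triangle g h j (a j)) y w
    [triangles] g h a y w = begin
      [ R g x y ∧ (R a y w ∧ R h x w) ]          ≈⟨ trans ([∧] _ _) (*-congˡ ([∧] _ _)) ⟩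
      [ R g x y ] * ([ R a y w ] * [ R h x w ])  ≈⟨ *-cong ([allB] _) (*-cong ([allB] _) ([allB] _)) ⟩
      product _ * (product _ * product _)        ≈⟨ trans (*-congˡ (product-* _ _)) (product-* _ _) ⟩
      ⨂ (λ j → triangle g h j (a j)) y w        ∎

    R-cong : ∀ g {a a′ b b′ : X} → (∀ i → a i ≡ a′ i) → (∀ i → b i ≡ b′ i) → R g a b ≡ R g a′ b′
    R-cong g a≗a′ b≗b′ =
      ≡.cong and (map-cong (λ i → ≡.cong₂ (λ u v → relU i u v ==₃ g i) (a≗a′ i) (b≗b′ i)) (allFin n))

    enum-complete : ∀ k (A : Fin k → Set) (L : (i : Fin k) → List (A i)) (u : (i : Fin k) → A i) →
      (∀ i → u i ∈ L i) → ∃ λ u′ → u′ ∈ enum k A L × (∀ i → u′ i ≡ u i)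
    enum-complete ℕ.zero    A L u _  = _ , here ≡.refl , λ ()
    enum-complete (ℕ.suc k) A L u u∈
      with enum-complete k (λ i → A (suc i)) (λ i → L (suc i)) (λ i → u (suc i)) (λ i → u∈ (suc i))
    ... | u′ , u′∈ , u′≗u = consF {A = A} (u zero) u′
                          , ∈-concat⁺′ (∈-map⁺ (consF {A = A} (u zero)) u′∈) (∈-map⁺ _ (u∈ zero))
                          , λ { zero → ≡.refl ; (suc i) → u′≗u i }

    allX-complete : ∀ (y : X) → ∃ λ y′ → y′ ∈ allX × (∀ i → y′ i ≡ y i)
    allX-complete y = enum-complete n U allU y λ j →
      ∈-concat⁺′ (∈-map⁺ (proj₁ (y j) ,_) (∈-allFin (proj₂ (y j)))) (∈-map⁺ _ (∈-allFin (proj₁ (y j))))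

    nonzero-intro : ∀ g a h y w → T (R g x y ∧ (R a y w ∧ R h x w)) → T (nonzero g a h)
    nonzero-intro g a h y w q with allX-complete y | allX-complete w
    ... | y′ , y′∈ , y′≗y | w′ , w′∈ , w′≗w =
      any⁺ _ (lose y′∈ (any⁺ _ (lose w′∈ (≡.subst T (≡.sym same) q))))
      where
        same : (R g x y′ ∧ (R a y′ w′ ∧ R h x w′)) ≡ (R g x y ∧ (R a y w ∧ R h x w))
        same = ≡.cong₂ _∧_ (R-cong g (λ _ → ≡.refl) y′≗y)
                 (≡.cong₂ _∧_ (R-cong a y′≗y w′≗w) (R-cong h (λ _ → ≡.refl) w′≗w))

    ΣM-if : ∀ (f : E → Mat) b a l y w → ΣM (map f (if b then a ∷ l else l)) y w ≈ [ b ] * f a y w + ΣM (map f l) y w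
    ΣM-if f true  a l y w = +-congʳ (sym (*-identityˡ _))
    ΣM-if f false a l y w = sym (trans (+-congʳ (zeroˡ _)) (+-identityˡ _))

    ΣM-filtered : ∀ (p : E → Bool) (f : E → Mat) (Φ : List E → Mat) → (∀ y w → Φ [] y w ≈ 0#) →
      (∀ a as y w → Φ (a ∷ as) y w ≈ [ p a ] * f a y w + Φ as y w) →
      ∀ as y w → Φ as y w ≈ ∑ₗ as (λ a → [ p a ] * f a y w)
    ΣM-filtered p f Φ Φ[] Φ∷ []       y w = Φ[] y w
    ΣM-filtered p f Φ Φ[] Φ∷ (a ∷ as) y w = trans (Φ∷ a as y w) (+-congˡ (ΣM-filtered p f Φ Φ[] Φ∷ as y w))

    -- B filters allE with a function local to its `where` block, which cannot be named here;
    -- abstracting allE lets Φ of ΣM-filtered be inferred as that filtered sum.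
    B-as-sum : ∀ g h τ y w → B g h τ y w ≈ ∑ₗ allE (λ a → [ admissible g h τ a ] * summand g h a y w)
    B-as-sum g h τ
      with allE | ΣM-filtered (admissible g h τ) (summand g h) _ (λ _ _ → refl)
                    (λ a as → ΣM-if (summand g h) (admissible g h τ a) a _)
    ... | as | filtered = filtered as

    [admissible] : ∀ g h τ a → [ admissible g h τ a ] ≈ [ nonzero g a h ] * product (λ j → [ admissibleAt g h τ j (a j) ])
    [admissible] g h τ@(J₁ , J₂ , J₃) a = begin
      [ nonzero g a h ∧ (X₁ ⊆ᵇ J₁) ∧ (X₂ ⊆ᵇ J₂) ∧ (X₃ ⊆ᵇ J₃) ]
        ≈⟨ trans ([∧] _ _) (*-congˡ (trans ([∧] _ _) (*-congˡ ([∧] _ _)))) ⟩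
      [ nonzero g a h ] * ([ X₁ ⊆ᵇ J₁ ] * ([ X₂ ⊆ᵇ J₂ ] * [ X₃ ⊆ᵇ J₃ ]))
        ≈⟨ *-congˡ (*-cong ([⊆ᵇ] X₁ J₁) (*-cong ([⊆ᵇ] X₂ J₂) ([⊆ᵇ] X₃ J₃))) ⟩
      [ nonzero g a h ] * (product (I X₁ J₁) * (product (I X₂ J₂) * product (I X₃ J₃)))
        ≈⟨ *-congˡ (trans (*-congˡ (product-* _ _)) (product-* _ _)) ⟩
      [ nonzero g a h ] * product (λ j → I X₁ J₁ j * (I X₂ J₂ j * I X₃ J₃ j))
        ≈⟨ *-congˡ (product-cong λ j → trans (sym (trans ([∧] _ _) (*-congˡ ([∧] _ _))))
                                             (reflexive (≡.cong [_] (pointwise j)))) ⟩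
      [ nonzero g a h ] * product (λ j → [ admissibleAt g h τ j (a j) ]) ∎
      where
        X₁ = S r1 a ∩ ((S r1 g ∩ S r1 h) S.∘)
        X₂ = S r2 a ∩ ((S r2 g ∩ S r2 h) •)
        X₃ = S r1 a ∩ S r2 g ∩ S r2 h
        I : Subset n → Subset n → Fin n → Carrier
        I P Q j = [ lookup P j ⇒ lookup Q j ]
        pointwise : ∀ j →
          ((lookup X₁ j ⇒ lookup J₁ j) ∧ (lookup X₂ j ⇒ lookup J₂ j) ∧ (lookup X₃ j ⇒ lookup J₃ j)) ≡
          admissibleAt g h τ j (a j)
        pointwise j = ≡.cong₂ _∧_
          (≡.cong (_⇒ lookup J₁ j) (∩-at (S r1 a) _ (S-at r1 a j) (∘-at (S r1 g ∩ S r1 h) (S∩S-at g j r1 h))))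
          (≡.cong₂ _∧_
          (≡.cong (_⇒ lookup J₂ j) (∩-at (S r2 a) _ (S-at r2 a j) (•-at (S r2 g ∩ S r2 h) (S∩S-at g j r2 h))))
          (≡.cong (_⇒ lookup J₃ j) (∩-at (S r1 a) _ (S-at r1 a j) (S∩S-at g j r2 h))))

    admissible-summand : ∀ g h τ a y w → [ admissible g h τ a ] * summand g h a y w ≈
                         product (λ j → [ admissibleAt g h τ j (a j) ] * triangle g h j (a j) (y j) (w j))
    admissible-summand g h τ a y w = begin
      [ admissible g h τ a ] * summand g h a y w
        ≈⟨ *-cong ([admissible] g h τ a) (summand-⨂ g h a y w) ⟩
      ([ nonzero g a h ] * Adm) * Tri
        ≈⟨ trans (*-congʳ (*-comm _ _)) (*-assoc _ _ _) ⟩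
      Adm * ([ nonzero g a h ] * Tri)
        ≈⟨ *-congˡ (trans (*-congˡ (sym ([triangles] g h a y w)))
                    (trans ([ nonzero g a h ]-absorbs (nonzero-intro g a h y w)) ([triangles] g h a y w))) ⟩
      Adm * Tri
        ≈⟨ product-* _ _ ⟩
      product (λ j → [ admissibleAt g h τ j (a j) ] * triangle g h j (a j) (y j) (w j)) ∎
      where
        Adm = product (λ j → [ admissibleAt g h τ j (a j) ])
        Tri = ⨂ (λ j → triangle g h j (a j)) y w

    β : E → E → Triple → (j : Fin n) → LocalMatrix j
    β g h τ j u w = [ Local.β (ℓ j) (m j) (g j) (h j) (τ at j) (x j) u w ]

    ∑-triangle : ∀ g h τ j u w →
      ∑ₗ (r0 ∷ r1 ∷ r2 ∷ []) (λ t → [ admissibleAt g h τ j t ] * triangle g h j t u w) ≈ β g h τ j u w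
    ∑-triangle g h τ j u w = begin
      ∑ₗ (r0 ∷ r1 ∷ r2 ∷ []) (λ t → [ adm t ] * (G * ([ relU j u w ==₃ t ] * H)))
        ≈⟨ ∑ₗ-cong (r0 ∷ r1 ∷ r2 ∷ []) (λ t → trans (*-congˡ (x∙yz≈y∙xz G [ relU j u w ==₃ t ] H))
                                                   (x∙yz≈y∙xz [ adm t ] [ relU j u w ==₃ t ] (G * H))) ⟩
      ∑ₗ (r0 ∷ r1 ∷ r2 ∷ []) (λ t → [ relU j u w ==₃ t ] * ([ adm t ] * (G * H)))
        ≈⟨ ∑-delta₃ (relU j u w) (λ t → [ adm t ] * (G * H)) ⟩
      [ adm (relU j u w) ] * (G * H)
        ≈⟨ sym (trans ([∧] _ _) (*-congˡ ([∧] _ _))) ⟩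
      [ adm (relU j u w) ∧ (relU j (x j) u ==₃ g j) ∧ (relU j (x j) w ==₃ h j) ]
        ≡⟨ ≡.cong [_] (≡.cong₂ (λ r s → adm r ∧ s) (relU≡rel j u w)
             (≡.cong₂ (λ r s → (r ==₃ g j) ∧ (s ==₃ h j)) (relU≡rel j (x j) u) (relU≡rel j (x j) w))) ⟩
      β g h τ j u w ∎
      where
        adm = admissibleAt g h τ j
        G = [ relU j (x j) u ==₃ g j ]
        H = [ relU j (x j) w ==₃ h j ]

    B-⨂ : ∀ g h τ → B g h τ ≈M ⨂ (β g h τ)
    B-⨂ g h τ y w = begin
      B g h τ y w
        ≈⟨ B-as-sum g h τ y w ⟩
      ∑ₗ allE (λ a → [ admissible g h τ a ] * summand g h a y w)
        ≈⟨ ∑ₗ-cong allE (λ a → admissible-summand g h τ a y w) ⟩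
      ∑ₗ allE (λ a → product (λ j → [ admissibleAt g h τ j (a j) ] * triangle g h j (a j) (y j) (w j)))
        ≈⟨ ∑-enum n (λ _ → Three) (λ _ → r0 ∷ r1 ∷ r2 ∷ [])
                  (λ j t → [ admissibleAt g h τ j t ] * triangle g h j t (y j) (w j)) ⟩
      product (λ j → ∑ₗ (r0 ∷ r1 ∷ r2 ∷ []) (λ t → [ admissibleAt g h τ j t ] * triangle g h j t (y j) (w j)))
        ≈⟨ product-cong (λ j → ∑-triangle g h τ j (y j) (w j)) ⟩
      ⨂ (β g h τ) y w ∎


    β⊙β : (∀ j → 2 ≤ ℓ j) → (∀ j → 2 ≤ m j) → ∀ g h i l τ σ → InU g h τ → InU l i σ → ∀ j u w →
          (β g h τ j ⊙ β l i σ j) u w ≈ ι (κ g h i l τ σ j) * β g i (comb g h i τ σ) j u w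
    β⊙β 2≤ℓ 2≤m g h i l τ σ τ∈ σ∈ j u w = begin
      ∑ₗ (allU j) (λ v → [ b₁ v ] * [ b₂ v ])
        ≈⟨ ∑ₗ-cong (allU j) (λ v → trans (sym ([∧] (b₁ v) (b₂ v))) (sym ι-[ b₁ v ∧ b₂ v ])) ⟩
      ∑ₗ (allU j) (λ v → ι ℕSums.[ b₁ v ∧ b₂ v ])
        ≈⟨ sym (ι-∑ₗ (allU j) (λ v → ℕSums.[ b₁ v ∧ b₂ v ])) ⟩
      ι (ℕSums.∑ₗ (allU j) (λ v → ℕSums.[ b₁ v ∧ b₂ v ]))
        ≡⟨ ≡.cong ι (Local.∑-β∧β (ℓ j) (m j) (2≤ℓ j) (2≤m j) (x j) u w (g j) (h j) (i j) (l j) (τ at j) (σ at j)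
                       (InU-at g h τ τ∈ j) (InU-at l i σ σ∈ j)) ⟩
      ι (κ g h i l τ σ j ℕ.* ℕSums.[ b₃ ])
        ≈⟨ trans (ι-* (κ g h i l τ σ j) ℕSums.[ b₃ ]) (*-congˡ ι-[ b₃ ]) ⟩
      ι (κ g h i l τ σ j) * [ b₃ ]
        ≡⟨ ≡.cong (λ t → ι (κ g h i l τ σ j) * [ Local.β (ℓ j) (m j) (g j) (i j) t (x j) u w ])
             (≡.sym (comb-at g h i τ σ j)) ⟩
      ι (κ g h i l τ σ j) * β g i (comb g h i τ σ) j u w ∎
      where
        b₁ = λ v → Local.β (ℓ j) (m j) (g j) (h j) (τ at j) (x j) u v
        b₂ = λ v → Local.β (ℓ j) (m j) (l j) (i j) (σ at j) (x j) v w
        b₃ = Local.β (ℓ j) (m j) (g j) (i j) (combₗ (bigL j) (bigM j) (g j) (h j) (i j) (τ at j) (σ at j)) (x j) u w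

theorem3p28 : {c ℓ' : Level} (F : Field c ℓ') (n : ℕ) → 1 ≤ n →
  (ℓ m : Fin n → ℕ) → (∀ i → 2 ≤ ℓ i) → (∀ i → 2 ≤ m i) →
  let open Setup F n ℓ m in
  (x : X) → let open Base x in
  (g h i l : E) (τ σ : Triple) → InU g h τ → InU l i σ →
  let open Field F in
  (B g h τ *M B l i σ)
    ≈M ((δ h l * ι k[ g , h , i ] * ι (kT (τ ∖ i)) * ι (kT (σ ∖ g)) * ι (kT (τ ∩T σ)))
         ·M B g i (comb g h i τ σ))
theorem3p28 F n _ ℓ m 2≤ℓ 2≤m x g h i l τ σ τ∈ σ∈ y z = begin
  (B g h τ *M B l i σ) y z
    ≈⟨ *M-⨂ (β g h τ) (β l i σ) (B-⨂ g h τ) (B-⨂ l i σ) y z ⟩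
  ⨂ (λ j → β g h τ j ⊙ β l i σ j) y z
    ≈⟨ product-cong (λ j → β⊙β 2≤ℓ 2≤m g h i l τ σ τ∈ σ∈ j (y j) (z j)) ⟩
  product (λ j → ι (κ g h i l τ σ j) * β g i (comb g h i τ σ) j (y j) (z j))
    ≈⟨ sym (product-* _ _) ⟩
  product (λ j → ι (κ g h i l τ σ j)) * ⨂ (β g i (comb g h i τ σ)) y z
    ≈⟨ *-cong (sym (scalar-⨂ g h i l τ σ)) (sym (B-⨂ g i (comb g h i τ σ) y z)) ⟩
  (δ h l * ι k[ g , h , i ] * ι (kT (τ ∖ i)) * ι (kT (σ ∖ g)) * ι (kT (τ ∩T σ))) * B g i (comb g h i τ σ) y z ∎
  where
    open Field F
    open Setup F n ℓ m
    open Base x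
    open Tensor F n ℓ m using (⨂; _⊙_; *M-⨂; product; product-cong; product-*; κ; scalar-⨂)
    open Tensor.AtBase F n ℓ m x using (β; B-⨂; β⊙β)
    open import Relation.Binary.Reasoning.Setoid setoid
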